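{- Let $n$ be a positive integer and $0\le k\le\lfloor n/2\rfloor$. The expected value, over the uniform distribution on Seidel matrices $S$ of tournaments of order $n$, of the coefficient $c_{2k}$ of $x^{n-2k}$ in the characteristic polynomial $\det(xI-S)$ equals the number of matchings of size $k$ (i.e., with exactly $k$ edges) in the complete graph $K_n$, namely $\binom{n}{2k}(2k-1)!!$. Consequently, the expected characteristic polynomial is $\sum_{k=0}^{\lfloor n/2\rfloor}\binom{n}{2k}(2k-1)!!\,x^{n-2k}$.
   Context: A tournament of order $n$ is a digraph on $\{1,\dots,n\}$ with exactly one of the arcs $ij$, $ji$ for each pair $i\ne j$. Its Seidel matrix $S=[s_{ij}]$ is the $n\times n$ skew-symmetric matrix with zero diagonal, $s_{ij}=1$ if $ij$ is an arc and $s_{ij}=-1$ otherwise; all $2^{\binom n2}$ are equally likely. A matching is a set of pairwise vertex-disjoint edges. $(-1)!!=1!!=1$, $m!!=m(m-2)!!$. -}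

module Defs where

open import Data.Bool using (Bool; true; false; if_then_else_; _∧_)
open import Data.Nat as ℕ using (ℕ; zero; suc; _∸_; _≤ᵇ_)
open import Data.Nat.Properties using (m^n≢0)
open import Data.Nat.Combinatorics using (_C_)
open import Data.Integer as ℤ using (ℤ; +_; -_)
open import Data.Rational using (ℚ; _/_)
open import Data.Fin using (Fin; zero; suc; punchIn; toℕ; _≟_)
open import Data.List using (List; []; _∷_; map; foldr; concatMap; allFin; replicate; _++_; upTo)
open import Data.Vec using (Vec; lookup)
import Data.Vec as Vec
open import Data.Product using (_×_; _,_)
open import Data.Unit using (⊤; tt)
open import Relation.Nullary using (does)

-- Polynomials over ℤ as coefficient lists, lowest degree first.

Poly : Set
Poly = List ℤ

infixl 6 _⊕_
_⊕_ : Poly → Poly → Poly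
[] ⊕ ys = ys
(x ∷ xs) ⊕ [] = x ∷ xs
(x ∷ xs) ⊕ (y ∷ ys) = (x ℤ.+ y) ∷ (xs ⊕ ys)

scale : ℤ → Poly → Poly
scale c = map (c ℤ.*_)

infixl 7 _⊗_
_⊗_ : Poly → Poly → Poly
[] ⊗ ys = []
(x ∷ xs) ⊗ ys = scale x ys ⊕ (+ 0 ∷ (xs ⊗ ys))

coeff : Poly → ℕ → ℤ
coeff [] i = + 0
coeff (x ∷ xs) zero = x
coeff (x ∷ xs) (suc i) = coeff xs i

monomial : ℕ → ℤ → Poly
monomial d c = replicate d (+ 0) ++ (c ∷ [])

sumP : List Poly → Poly
sumP = foldr _⊕_ []

sgn : ℕ → ℤ
sgn zero = + 1
sgn (suc m) = - sgn m

det : (n : ℕ) → (Fin n → Fin n → Poly) → Poly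
det zero M = + 1 ∷ []
det (suc n) M =
  sumP (map (λ j → scale (sgn (toℕ j))
                     (M zero j ⊗ det n (λ a b → M (suc a) (punchIn j b))))
            (allFin (suc n)))

charPoly : (n : ℕ) → (Fin n → Fin n → ℤ) → Poly
charPoly n S = det n (λ i j → (if does (i ≟ j) then (+ 0 ∷ + 1 ∷ []) else [])
                              ⊕ (- S i j ∷ []))

-- A tournament on {0,…,n} (i.e. order suc n)
-- is given by the orientations of the arcs between vertex 0 and vertices
-- 1..n (true = arc 0→j) together with a tournament on the remaining n
-- vertices.  This is a bijective encoding of all 2^(n C 2) tournaments.

Tour : ℕ → Set
Tour zero = ⊤
Tour (suc n) = Vec Bool n × Tour n

pm : Bool → ℤ
pm true = + 1
pm false = - (+ 1)

seidel : {n : ℕ} → Tour n → Fin n → Fin n → ℤ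
seidel {suc n} (v , t) zero zero = + 0
seidel {suc n} (v , t) zero (suc j) = pm (lookup v j)
seidel {suc n} (v , t) (suc i) zero = - pm (lookup v i)
seidel {suc n} (v , t) (suc i) (suc j) = seidel t i j

allVecs : (n : ℕ) → List (Vec Bool n)
allVecs zero = Vec.[] ∷ []
allVecs (suc n) = concatMap (λ v → (true Vec.∷ v) ∷ (false Vec.∷ v) ∷ []) (allVecs n)

allTours : (n : ℕ) → List (Tour n)
allTours zero = tt ∷ []
allTours (suc n) = concatMap (λ v → map (v ,_) (allTours n)) (allVecs n)

sumℤ : List ℤ → ℤ
sumℤ = foldr ℤ._+_ (+ 0)

expect : (n : ℕ) → (Tour n → ℤ) → ℚ
expect n f = _/_ (sumℤ (map f (allTours n))) (2 ℕ.^ (n C 2)) {{m^n≢0 2 (n C 2)}}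

-- Matchings in K_n.  An edge set of K_n is encoded the same way as a
-- tournament (true = edge present between vertex 0 and vertex j+1).

EdgeSet : ℕ → Set
EdgeSet = Tour

adj : {n : ℕ} → EdgeSet n → Fin n → Fin n → Bool
adj {suc n} (v , t) zero zero = false
adj {suc n} (v , t) zero (suc j) = lookup v j
adj {suc n} (v , t) (suc i) zero = lookup v i
adj {suc n} (v , t) (suc i) (suc j) = adj t i j

countTrue : List Bool → ℕ
countTrue = foldr (λ b m → if b then suc m else m) 0

degree : {n : ℕ} → EdgeSet n → Fin n → ℕ
degree {n} E u = countTrue (map (adj E u) (allFin n))

size : {n : ℕ} → EdgeSet n → ℕ
size {zero} tt = 0
size {suc n} (v , t) = countTrue (Vec.toList v) ℕ.+ size t

-- pairwise vertex-disjoint edges  ⇔  every vertex has degree ≤ 1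
allB : {A : Set} → (A → Bool) → List A → Bool
allB p = foldr (λ a b → p a ∧ b) true

isMatching : {n : ℕ} → EdgeSet n → Bool
isMatching {n} E = allB (λ u → degree E u ≤ᵇ 1) (allFin n)

matchings : ℕ → ℕ → ℕ
matchings n k =
  countTrue (map (λ E → isMatching E ∧ does (size E ℕ.≟ k)) (allTours n))

_!! : ℕ → ℕ
zero !! = 1
suc zero !! = 1
suc (suc m) !! = suc (suc m) ℕ.* (m !!)

-- (2k-1)!!, with the convention (-1)!! = 1 for k = 0.
oddDF : ℕ → ℕ
oddDF k = (2 ℕ.* k ∸ 1) !!

expectedCharPoly : ℕ → Poly
expectedCharPoly n =
  sumP (map (λ k → monomial (n ∸ 2 ℕ.* k) (+ ((n C (2 ℕ.* k)) ℕ.* oddDF k)))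
            (upTo (suc (n ℕ./ 2))))

-- Let Q n be the sum of det (xI − S) over the 2^(n C 2) tournaments of order n.  Expanding along
-- row 0 gives x · det (xI − S′), for the tournament S′ on the vertices other than 0, plus terms which, after a
-- second expansion along column 0, are products s₀ⱼ s₀ₐ times minors not involving row or column 0.
-- The signs s₀ⱼ are independent and uniform, so summing over them kills the terms with a ≠ j, and the
-- term with a = j is det (xI − S) with the vertices 0 and j deleted.  Hence
--   Q (m + 2) = 2^(m+1) (x Q (m + 1) + (m + 1) 2^m Q m),
-- so Q n / 2^(n C 2) satisfies P (m + 2) = x P (m + 1) + (m + 1) P m.  This is also the recurrence of
-- Σₖ C(n, 2k) (2k − 1)!! x^(n − 2k) and, coefficientwise, of the number of k-matchings of K_n: vertex 0
-- is either unmatched, or matched to one of the other m + 1 vertices, whose removal leaves a matching of K_m.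

module Submission where

open import Defs
open import Data.Bool using (Bool; true; false; if_then_else_; _∧_)
open import Data.Bool.Properties using (∧-zeroʳ)
open import Data.Integer using (ℤ; +_; -_; _+_; _*_; _^_)
import Data.Integer.Properties as ℤ
open import Data.Integer.Tactic.RingSolver using (solve-∀)
open import Data.Nat as ℕ using (ℕ; zero; suc; _∸_; _<_; _≤_; _≤ᵇ_; z≤n; s≤s; _/_; NonZero)
import Data.Nat.DivMod as ℕ
import Data.Nat.Properties as ℕ
import Data.Nat.Tactic.RingSolver as ℕ
open import Data.Nat.Combinatorics using (_C_; nC1≡n; nCk+nC[k+1]≡[n+1]C[k+1]; k>n⇒nCk≡0)
open import Data.Fin using (Fin; zero; suc; punchIn; toℕ; _≟_)
open import Data.Fin.Properties using (punchIn-injective; toℕ<n; toℕ-inject₁; toℕ-fromℕ)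
open import Data.Fin.Subset using (⊥; ⁅_⁆)
open import Data.List using (List; []; _∷_; map; _++_; concatMap; allFin; tabulate; applyUpTo; upTo)
import Data.List.Properties as List
open import Data.Vec using (Vec; lookup; removeAt; toList) renaming ([] to []ᵥ; _∷_ to _∷ᵥ_)
open import Data.Vec.Properties using (lookup-replicate)
open import Data.Product using (_×_; _,_)
import Data.Rational as ℚ
import Data.Rational.Properties as ℚ
open import Data.Rational.Unnormalised using (mkℚᵘ; *≡*)
open import Function using (_∘_; mk⇔)
open import Relation.Nullary using (¬_; does; contradiction)
open import Relation.Nullary.Decidable using (does-⇔)
open import Relation.Binary.PropositionalEquality
open ≡-Reasoning
open import Algebra.Properties.CommutativeSemigroup ℤ.+-commutativeSemigroup using (interchange)
open import Algebra.Properties.Semiring.Sum ℤ.+-*-semiring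
  using (sum-syntax; sum-cong-≗; sum-replicate-zero; sum-init-last; ∑-distrib-+; ∑-comm; *-distribˡ-sum)

private
  variable
    A B : Set
    n : ℕ

∑ₗ : List A → (A → ℤ) → ℤ
∑ₗ xs f = sumℤ (map f xs)

infixl 10 ∑ₗ
syntax ∑ₗ xs (λ x → e) = ∑[ x ∈ xs ] e

∑ₗ-cong : (xs : List A) {f g : A → ℤ} → (∀ x → f x ≡ g x) → ∑ₗ xs f ≡ ∑ₗ xs g
∑ₗ-cong xs f≗g = cong sumℤ (List.map-cong f≗g xs)

∑ₗ-zero : (xs : List A) → ∑[ x ∈ xs ] (+ 0) ≡ + 0
∑ₗ-zero []       = refl
∑ₗ-zero (x ∷ xs) = trans (ℤ.+-identityˡ _) (∑ₗ-zero xs)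

∑ₗ-distrib-+ : (xs : List A) (f g : A → ℤ) → ∑[ x ∈ xs ] (f x + g x) ≡ ∑ₗ xs f + ∑ₗ xs g
∑ₗ-distrib-+ []       f g = refl
∑ₗ-distrib-+ (x ∷ xs) f g = begin
  f x + g x + ∑[ y ∈ xs ] (f y + g y) ≡⟨ cong (_+_ (f x + g x)) (∑ₗ-distrib-+ xs f g) ⟩
  f x + g x + (∑ₗ xs f + ∑ₗ xs g)     ≡⟨ interchange (f x) (g x) _ _ ⟩
  f x + ∑ₗ xs f + (g x + ∑ₗ xs g)     ∎

*-distribˡ-∑ₗ : (c : ℤ) (xs : List A) (f : A → ℤ) → c * ∑ₗ xs f ≡ ∑[ x ∈ xs ] (c * f x)
*-distribˡ-∑ₗ c []       f = ℤ.*-zeroʳ c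
*-distribˡ-∑ₗ c (x ∷ xs) f =
  trans (ℤ.*-distribˡ-+ c (f x) _) (cong (_+_ (c * f x)) (*-distribˡ-∑ₗ c xs f))

*-distribʳ-∑ₗ : (c : ℤ) (xs : List A) (f : A → ℤ) → ∑ₗ xs f * c ≡ ∑[ x ∈ xs ] (f x * c)
*-distribʳ-∑ₗ c xs f = begin
  ∑ₗ xs f * c             ≡⟨ ℤ.*-comm _ c ⟩
  c * ∑ₗ xs f             ≡⟨ *-distribˡ-∑ₗ c xs f ⟩
  ∑[ x ∈ xs ] (c * f x)   ≡⟨ ∑ₗ-cong xs (λ x → ℤ.*-comm c (f x)) ⟩
  ∑[ x ∈ xs ] (f x * c)   ∎

∑ₗ-++ : (xs ys : List A) (f : A → ℤ) → ∑ₗ (xs ++ ys) f ≡ ∑ₗ xs f + ∑ₗ ys f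
∑ₗ-++ []       ys f = sym (ℤ.+-identityˡ _)
∑ₗ-++ (x ∷ xs) ys f = trans (cong (_+_ (f x)) (∑ₗ-++ xs ys f)) (sym (ℤ.+-assoc (f x) _ _))

∑ₗ-map : (g : A → B) (xs : List A) (f : B → ℤ) → ∑ₗ (map g xs) f ≡ ∑ₗ xs (f ∘ g)
∑ₗ-map g xs f = cong sumℤ (sym (List.map-∘ xs))

∑ₗ-concatMap : (g : A → List B) (xs : List A) (f : B → ℤ) →
               ∑ₗ (concatMap g xs) f ≡ ∑[ x ∈ xs ] ∑ₗ (g x) f
∑ₗ-concatMap g []       f = refl
∑ₗ-concatMap g (x ∷ xs) f =
  trans (∑ₗ-++ (g x) (concatMap g xs) f) (cong (_+_ (∑ₗ (g x) f)) (∑ₗ-concatMap g xs f))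

∑ₗ-comm : (xs : List A) (ys : List B) (f : A → B → ℤ) →
          ∑[ x ∈ xs ] ∑[ y ∈ ys ] f x y ≡ ∑[ y ∈ ys ] ∑[ x ∈ xs ] f x y
∑ₗ-comm []       ys f = sym (∑ₗ-zero ys)
∑ₗ-comm (x ∷ xs) ys f =
  trans (cong (_+_ (∑ₗ ys (f x))) (∑ₗ-comm xs ys f)) (sym (∑ₗ-distrib-+ ys (f x) _))

∑ₗ-tabulate : (n : ℕ) (g : Fin n → A) (f : A → ℤ) →
              ∑ₗ (tabulate g) f ≡ ∑[ i < n ] f (g i)
∑ₗ-tabulate zero    g f = refl
∑ₗ-tabulate (suc n) g f = cong (_+_ (f (g zero))) (∑ₗ-tabulate n (g ∘ suc) f)

∑ₗ-allFin : (n : ℕ) (f : Fin n → ℤ) → ∑ₗ (allFin n) f ≡ ∑[ i < n ] f i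
∑ₗ-allFin n = ∑ₗ-tabulate n (λ i → i)

∑ₗ-∑-comm : (xs : List A) (n : ℕ) (f : A → Fin n → ℤ) →
            ∑[ x ∈ xs ] ∑[ i < n ] f x i ≡ ∑[ i < n ] ∑[ x ∈ xs ] f x i
∑ₗ-∑-comm xs n f = begin
  ∑[ x ∈ xs ] ∑[ i < n ] f x i          ≡⟨ ∑ₗ-cong xs (λ x → sym (∑ₗ-allFin n (f x))) ⟩
  ∑[ x ∈ xs ] ∑[ i ∈ allFin n ] f x i   ≡⟨ ∑ₗ-comm xs (allFin n) f ⟩
  ∑[ i ∈ allFin n ] ∑[ x ∈ xs ] f x i   ≡⟨ ∑ₗ-allFin n _ ⟩
  ∑[ i < n ] ∑[ x ∈ xs ] f x i          ∎

∑-const : (n : ℕ) (c : ℤ) → ∑[ i < n ] c ≡ + n * c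
∑-const zero    c = sym (ℤ.*-zeroˡ c)
∑-const (suc n) c = begin
  c + ∑[ i < n ] c ≡⟨ cong (_+_ c) (∑-const n c) ⟩
  c + + n * c      ≡⟨ cong (_+ + n * c) (sym (ℤ.*-identityˡ c)) ⟩
  + 1 * c + + n * c ≡⟨ ℤ.*-distribʳ-+ c (+ 1) (+ n) ⟨
  + suc n * c      ∎

∑ₗ-applyUpTo : (f : ℕ → A) (L : ℕ) (g : A → ℤ) → ∑ₗ (applyUpTo f L) g ≡ ∑[ k < L ] g (f (toℕ k))
∑ₗ-applyUpTo f zero    g = refl
∑ₗ-applyUpTo f (suc L) g = cong (_+_ (g (f 0))) (∑ₗ-applyUpTo (f ∘ suc) L g)

∑-toℕ-last : (L : ℕ) (g : ℕ → ℤ) → ∑[ k < suc L ] g (toℕ k) ≡ ∑[ k < L ] g (toℕ k) + g L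
∑-toℕ-last L g = trans (sum-init-last {L} (λ k → g (toℕ k)))
  (cong₂ _+_ (sum-cong-≗ {L} (λ k → cong g (toℕ-inject₁ k))) (cong g (toℕ-fromℕ L)))

∑-toℕ-δ : (L : ℕ) (f : ℕ → ℤ) (k : ℕ) → k < L → (∀ j → j < L → ¬ j ≡ k → f j ≡ + 0) →
          ∑[ j < L ] f (toℕ j) ≡ f k
∑-toℕ-δ (suc L) f zero    _         off = begin
  f 0 + ∑[ j < L ] f (suc (toℕ j))
    ≡⟨ cong (_+_ (f 0)) (sum-cong-≗ {L} (λ j → off (suc (toℕ j)) (s≤s (toℕ<n j)) (λ ()))) ⟩
  f 0 + ∑[ j < L ] (+ 0)             ≡⟨ cong (_+_ (f 0)) (sum-replicate-zero L) ⟩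
  f 0 + + 0                          ≡⟨ ℤ.+-identityʳ (f 0) ⟩
  f 0                                ∎
∑-toℕ-δ (suc L) f (suc k) (s≤s k<L) off = begin
  f 0 + ∑[ j < L ] f (suc (toℕ j))   ≡⟨ cong (_+ ∑[ j < L ] f (suc (toℕ j))) (off 0 (s≤s z≤n) (λ ())) ⟩
  + 0 + ∑[ j < L ] f (suc (toℕ j))   ≡⟨ ℤ.+-identityˡ _ ⟩
  ∑[ j < L ] f (suc (toℕ j))         ≡⟨ ∑-toℕ-δ L (f ∘ suc) k k<L off′ ⟩
  f (suc k)                          ∎
  where
  off′ : ∀ j → j < L → ¬ j ≡ k → f (suc j) ≡ + 0
  off′ j j<L j≢k = off (suc j) (s≤s j<L) (λ j+1≡k+1 → j≢k (cong ℕ.pred j+1≡k+1))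

shift : (ℕ → ℤ) → ℕ → ℤ
shift f zero    = + 0
shift f (suc i) = f i

shift-cong : {f g : ℕ → ℤ} → (∀ i → f i ≡ g i) → ∀ i → shift f i ≡ shift g i
shift-cong f≗g zero    = refl
shift-cong f≗g (suc i) = f≗g i

shift-+ : (f g : ℕ → ℤ) (i : ℕ) → shift (λ k → f k + g k) i ≡ shift f i + shift g i
shift-+ f g zero    = refl
shift-+ f g (suc i) = refl

shift-∑ : (n : ℕ) (f : Fin n → ℕ → ℤ) (i : ℕ) → shift (λ k → ∑[ a < n ] f a k) i ≡ ∑[ a < n ] shift (f a) i
shift-∑ n f zero    = sym (sum-replicate-zero n)
shift-∑ n f (suc i) = refl

shift-* : (c : ℤ) (f : ℕ → ℤ) (i : ℕ) → shift (λ k → c * f k) i ≡ c * shift f i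
shift-* c f zero    = sym (ℤ.*-zeroʳ c)
shift-* c f (suc i) = refl

shift-∑ₗ : (xs : List A) (f : A → ℕ → ℤ) (i : ℕ) →
           ∑[ x ∈ xs ] shift (f x) i ≡ shift (λ k → ∑[ x ∈ xs ] f x k) i
shift-∑ₗ xs f zero    = ∑ₗ-zero xs
shift-∑ₗ xs f (suc i) = refl

-- p ⊛ coeff q is the coefficient sequence of p ⊗ q (coeff-⊗), which lets us reason about the
-- unnormalised lists of Poly coefficientwise.
infixr 7 _⊛_
_⊛_ : Poly → (ℕ → ℤ) → ℕ → ℤ
([]      ⊛ f) i = + 0
((x ∷ p) ⊛ f) i = x * f i + shift (p ⊛ f) i

coeff-⊕ : (p q : Poly) (i : ℕ) → coeff (p ⊕ q) i ≡ coeff p i + coeff q i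
coeff-⊕ []      q       i       = sym (ℤ.+-identityˡ _)
coeff-⊕ (x ∷ p) []      i       = sym (ℤ.+-identityʳ _)
coeff-⊕ (x ∷ p) (y ∷ q) zero    = refl
coeff-⊕ (x ∷ p) (y ∷ q) (suc i) = coeff-⊕ p q i

coeff-scale : (c : ℤ) (p : Poly) (i : ℕ) → coeff (scale c p) i ≡ c * coeff p i
coeff-scale c []      i       = sym (ℤ.*-zeroʳ c)
coeff-scale c (x ∷ p) zero    = refl
coeff-scale c (x ∷ p) (suc i) = coeff-scale c p i

coeff-sumP : (xs : List A) (f : A → Poly) (i : ℕ) →
             coeff (sumP (map f xs)) i ≡ ∑[ x ∈ xs ] coeff (f x) i
coeff-sumP []       f i = refl
coeff-sumP (x ∷ xs) f i = trans (coeff-⊕ (f x) _ i) (cong (_+_ (coeff (f x) i)) (coeff-sumP xs f i))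

coeff-0∷ : (p : Poly) (i : ℕ) → coeff (+ 0 ∷ p) i ≡ shift (coeff p) i
coeff-0∷ p zero    = refl
coeff-0∷ p (suc i) = refl

coeff-⊗ : (p q : Poly) (i : ℕ) → coeff (p ⊗ q) i ≡ (p ⊛ coeff q) i
coeff-⊗ []      q i = refl
coeff-⊗ (x ∷ p) q i = begin
  coeff (scale x q ⊕ (+ 0 ∷ p ⊗ q)) i              ≡⟨ coeff-⊕ (scale x q) _ i ⟩
  coeff (scale x q) i + coeff (+ 0 ∷ p ⊗ q) i      ≡⟨ cong₂ _+_ (coeff-scale x q i) (coeff-0∷ (p ⊗ q) i) ⟩
  x * coeff q i + shift (coeff (p ⊗ q)) i          ≡⟨ cong (_+_ (x * coeff q i)) (shift-cong (coeff-⊗ p q) i) ⟩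
  x * coeff q i + shift (p ⊛ coeff q) i            ∎

⊛-cong : (p : Poly) {f g : ℕ → ℤ} → (∀ i → f i ≡ g i) → ∀ i → (p ⊛ f) i ≡ (p ⊛ g) i
⊛-cong []      f≗g i = refl
⊛-cong (x ∷ p) f≗g i = cong₂ (λ a b → x * a + b) (f≗g i) (shift-cong (⊛-cong p f≗g) i)

⊛-∑ : (p : Poly) (n : ℕ) (c : Fin n → ℤ) (f : Fin n → ℕ → ℤ) (i : ℕ) →
      (p ⊛ (λ k → ∑[ a < n ] (c a * f a k))) i ≡ ∑[ a < n ] (c a * (p ⊛ f a) i)
⊛-∑ []      n c f i = sym (trans (sum-cong-≗ (λ a → ℤ.*-zeroʳ (c a))) (sum-replicate-zero n))
⊛-∑ (x ∷ p) n c f i = begin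
  x * ∑[ a < n ] (c a * f a i) + shift (p ⊛ (λ k → ∑[ a < n ] (c a * f a k))) i
    ≡⟨ cong₂ _+_ (*-distribˡ-sum {n} x (λ a → c a * f a i)) shifted ⟩
  ∑[ a < n ] (x * (c a * f a i)) + ∑[ a < n ] (c a * shift (p ⊛ f a) i)
    ≡⟨ ∑-distrib-+ {n} _ _ ⟨
  ∑[ a < n ] (x * (c a * f a i) + c a * shift (p ⊛ f a) i)
    ≡⟨ sum-cong-≗ {n} (λ a → reassoc x (c a) (f a i) _) ⟩
  ∑[ a < n ] (c a * (x * f a i + shift (p ⊛ f a) i))
    ∎
  where
  shifted : shift (p ⊛ (λ k → ∑[ a < n ] (c a * f a k))) i ≡ ∑[ a < n ] (c a * shift (p ⊛ f a) i)
  shifted = begin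
    shift (p ⊛ (λ k → ∑[ a < n ] (c a * f a k))) i   ≡⟨ shift-cong (⊛-∑ p n c f) i ⟩
    shift (λ k → ∑[ a < n ] (c a * (p ⊛ f a) k)) i   ≡⟨ shift-∑ n (λ a k → c a * (p ⊛ f a) k) i ⟩
    ∑[ a < n ] shift (λ k → c a * (p ⊛ f a) k) i     ≡⟨ sum-cong-≗ {n} (λ a → shift-* (c a) (p ⊛ f a) i) ⟩
    ∑[ a < n ] (c a * shift (p ⊛ f a) i)             ∎
  reassoc : ∀ x c y z → x * (c * y) + c * z ≡ c * (x * y + z)
  reassoc = solve-∀

coeff-const-⊗ : (c : ℤ) (q : Poly) (i : ℕ) → coeff ((c ∷ []) ⊗ q) i ≡ c * coeff q i
coeff-const-⊗ c q zero    = trans (coeff-⊗ (c ∷ []) q 0) (ℤ.+-identityʳ _)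
coeff-const-⊗ c q (suc i) = trans (coeff-⊗ (c ∷ []) q (suc i)) (ℤ.+-identityʳ _)

coeff-x-⊗ : (q : Poly) (i : ℕ) → coeff ((+ 0 ∷ + 1 ∷ []) ⊗ q) i ≡ shift (coeff q) i
coeff-x-⊗ q zero    = coeff-⊗ (+ 0 ∷ + 1 ∷ []) q 0
coeff-x-⊗ q (suc i) = begin
  coeff ((+ 0 ∷ + 1 ∷ []) ⊗ q) (suc i)   ≡⟨ coeff-⊗ (+ 0 ∷ + 1 ∷ []) q (suc i) ⟩
  + 0 + ((+ 1 ∷ []) ⊛ coeff q) i         ≡⟨ ℤ.+-identityˡ _ ⟩
  ((+ 1 ∷ []) ⊛ coeff q) i               ≡⟨ coeff-⊗ (+ 1 ∷ []) q i ⟨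
  coeff ((+ 1 ∷ []) ⊗ q) i               ≡⟨ coeff-const-⊗ (+ 1) q i ⟩
  + 1 * coeff q i                        ≡⟨ ℤ.*-identityˡ _ ⟩
  coeff q i                              ∎

minor : (Fin (suc n) → Fin (suc n) → A) → Fin (suc n) → Fin (suc n) →
        Fin n → Fin n → A
minor M a b x y = M (punchIn a x) (punchIn b y)

coeff-det : (n : ℕ) (M : Fin (suc n) → Fin (suc n) → Poly) (i : ℕ) →
            coeff (det (suc n) M) i ≡
            ∑[ j < suc n ] (sgn (toℕ j) * coeff (M zero j ⊗ det n (minor M zero j)) i)
coeff-det n M i = begin
  coeff (det (suc n) M) i
    ≡⟨ coeff-sumP (allFin (suc n)) (λ j → scale (sgn (toℕ j)) (M zero j ⊗ det n (minor M zero j))) i ⟩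
  ∑[ j ∈ allFin (suc n) ] coeff (scale (sgn (toℕ j)) (M zero j ⊗ det n (minor M zero j))) i
    ≡⟨ ∑ₗ-cong (allFin (suc n)) (λ j → coeff-scale (sgn (toℕ j)) (M zero j ⊗ det n (minor M zero j)) i) ⟩
  ∑[ j ∈ allFin (suc n) ] (sgn (toℕ j) * coeff (M zero j ⊗ det n (minor M zero j)) i)
    ≡⟨ ∑ₗ-allFin (suc n) (λ j → sgn (toℕ j) * coeff (M zero j ⊗ det n (minor M zero j)) i) ⟩
  ∑[ j < suc n ] (sgn (toℕ j) * coeff (M zero j ⊗ det n (minor M zero j)) i)
    ∎

det-cong : (n : ℕ) {M M′ : Fin n → Fin n → Poly} → (∀ a b → M a b ≡ M′ a b) → det n M ≡ det n M′
det-cong zero    M≗M′ = refl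
det-cong (suc n) M≗M′ = cong sumP (List.map-cong
  (λ j → cong₂ (λ p q → scale (sgn (toℕ j)) (p ⊗ q)) (M≗M′ zero j) (det-cong n (λ a b → M≗M′ (suc a) (punchIn j b))))
  (allFin (suc n)))

-- Laplace expansion along column 0.  The entries of that column are constants here, which commute
-- with every polynomial, so no commutativity of ⊗ is needed.
det-expand-col₀ : (m : ℕ) (N : Fin (suc m) → Fin (suc m) → Poly) (c : Fin (suc m) → ℤ) →
                  (∀ a → N a zero ≡ c a ∷ []) → ∀ i →
                  coeff (det (suc m) N) i ≡
                  ∑[ a < suc m ] (sgn (toℕ a) * c a * coeff (det m (minor N a zero)) i)
det-expand-col₀ zero N c N·₀≡c i = begin
  coeff (det 1 N) i                                   ≡⟨ coeff-det 0 N i ⟩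
  + 1 * coeff (N zero zero ⊗ (+ 1 ∷ [])) i + + 0      ≡⟨ cong (λ p → + 1 * coeff (p ⊗ (+ 1 ∷ [])) i + + 0) (N·₀≡c zero) ⟩
  + 1 * coeff ((c zero ∷ []) ⊗ (+ 1 ∷ [])) i + + 0    ≡⟨ cong (λ z → + 1 * z + + 0) (coeff-const-⊗ (c zero) (+ 1 ∷ []) i) ⟩
  + 1 * (c zero * coeff (+ 1 ∷ []) i) + + 0           ≡⟨ cong (_+ + 0) (ℤ.*-assoc (+ 1) (c zero) _) ⟨
  + 1 * c zero * coeff (+ 1 ∷ []) i + + 0             ∎
det-expand-col₀ (suc m) N c N·₀≡c i = begin
  coeff (det (suc (suc m)) N) i
    ≡⟨ coeff-det (suc m) N i ⟩
  + 1 * coeff (N zero zero ⊗ D₀) i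
    + ∑[ j < suc m ] (- sgn (toℕ j) * coeff (N zero (suc j) ⊗ det (suc m) (minor N zero (suc j))) i)
    ≡⟨ cong₂ _+_ first-term (sum-cong-≗ {suc m} (λ j → cong (- sgn (toℕ j) *_) (expand-minor j))) ⟩
  + 1 * c zero * coeff D₀ i + ∑[ j < suc m ] (- sgn (toℕ j) * ∑[ a < suc m ] (sgn (toℕ a) * c (suc a) * X j a))
    ≡⟨ cong (_+_ (+ 1 * c zero * coeff D₀ i)) swap-signs ⟩
  + 1 * c zero * coeff D₀ i + ∑[ a < suc m ] (- sgn (toℕ a) * c (suc a) * ∑[ j < suc m ] (sgn (toℕ j) * X j a))
    ≡⟨ cong (_+_ (+ 1 * c zero * coeff D₀ i))
            (sum-cong-≗ {suc m} (λ a → cong (- sgn (toℕ a) * c (suc a) *_) (coeff-det m (minor N (suc a) zero) i))) ⟨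
  + 1 * c zero * coeff D₀ i + ∑[ a < suc m ] (- sgn (toℕ a) * c (suc a) * coeff (det (suc m) (minor N (suc a) zero)) i)
    ∎
  where
  D₀ : Poly
  D₀ = det (suc m) (minor N zero zero)

  X : Fin (suc m) → Fin (suc m) → ℤ
  X j a = coeff (N zero (suc j) ⊗ det m (minor (minor N (suc a) zero) zero j)) i

  first-term : + 1 * coeff (N zero zero ⊗ D₀) i ≡ + 1 * c zero * coeff D₀ i
  first-term = begin
    + 1 * coeff (N zero zero ⊗ D₀) i       ≡⟨ cong (λ p → + 1 * coeff (p ⊗ D₀) i) (N·₀≡c zero) ⟩
    + 1 * coeff ((c zero ∷ []) ⊗ D₀) i     ≡⟨ cong (+ 1 *_) (coeff-const-⊗ (c zero) D₀ i) ⟩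
    + 1 * (c zero * coeff D₀ i)            ≡⟨ ℤ.*-assoc (+ 1) (c zero) _ ⟨
    + 1 * c zero * coeff D₀ i              ∎

  expand-minor : ∀ j → coeff (N zero (suc j) ⊗ det (suc m) (minor N zero (suc j))) i ≡
                       ∑[ a < suc m ] (sgn (toℕ a) * c (suc a) * X j a)
  expand-minor j = begin
    coeff (N zero (suc j) ⊗ det (suc m) (minor N zero (suc j))) i
      ≡⟨ coeff-⊗ (N zero (suc j)) _ i ⟩
    (N zero (suc j) ⊛ coeff (det (suc m) (minor N zero (suc j)))) i
      ≡⟨ ⊛-cong (N zero (suc j)) (det-expand-col₀ m (minor N zero (suc j)) (λ a → c (suc a)) (λ a → N·₀≡c (suc a))) i ⟩
    (N zero (suc j) ⊛ (λ k → ∑[ a < suc m ] (sgn (toℕ a) * c (suc a) * coeff (det m (minor (minor N (suc a) zero) zero j)) k))) i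
      ≡⟨ ⊛-∑ (N zero (suc j)) (suc m) (λ a → sgn (toℕ a) * c (suc a)) (λ a → coeff (det m (minor (minor N (suc a) zero) zero j))) i ⟩
    ∑[ a < suc m ] (sgn (toℕ a) * c (suc a) * (N zero (suc j) ⊛ coeff (det m (minor (minor N (suc a) zero) zero j))) i)
      ≡⟨ sum-cong-≗ {suc m} (λ a → cong (sgn (toℕ a) * c (suc a) *_)
                                         (coeff-⊗ (N zero (suc j)) (det m (minor (minor N (suc a) zero) zero j)) i)) ⟨
    ∑[ a < suc m ] (sgn (toℕ a) * c (suc a) * X j a)
      ∎

  swap-signs : ∑[ j < suc m ] (- sgn (toℕ j) * ∑[ a < suc m ] (sgn (toℕ a) * c (suc a) * X j a)) ≡
               ∑[ a < suc m ] (- sgn (toℕ a) * c (suc a) * ∑[ j < suc m ] (sgn (toℕ j) * X j a))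
  swap-signs = begin
    ∑[ j < suc m ] (- sgn (toℕ j) * ∑[ a < suc m ] (sgn (toℕ a) * c (suc a) * X j a))
      ≡⟨ sum-cong-≗ {suc m} (λ j → *-distribˡ-sum {suc m} (- sgn (toℕ j)) (λ a → sgn (toℕ a) * c (suc a) * X j a)) ⟩
    ∑[ j < suc m ] ∑[ a < suc m ] (- sgn (toℕ j) * (sgn (toℕ a) * c (suc a) * X j a))
      ≡⟨ ∑-comm {suc m} {suc m} (λ j a → - sgn (toℕ j) * (sgn (toℕ a) * c (suc a) * X j a)) ⟩
    ∑[ a < suc m ] ∑[ j < suc m ] (- sgn (toℕ j) * (sgn (toℕ a) * c (suc a) * X j a))
      ≡⟨ sum-cong-≗ {suc m} (λ a → sum-cong-≗ {suc m} (λ j → move-sign (sgn (toℕ j)) (sgn (toℕ a)) (c (suc a)) (X j a))) ⟩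
    ∑[ a < suc m ] ∑[ j < suc m ] (- sgn (toℕ a) * c (suc a) * (sgn (toℕ j) * X j a))
      ≡⟨ sum-cong-≗ {suc m} (λ a → *-distribˡ-sum {suc m} (- sgn (toℕ a) * c (suc a)) (λ j → sgn (toℕ j) * X j a)) ⟨
    ∑[ a < suc m ] (- sgn (toℕ a) * c (suc a) * ∑[ j < suc m ] (sgn (toℕ j) * X j a))
      ∎
    where
    move-sign : ∀ s t c x → - s * (t * c * x) ≡ - t * c * (s * x)
    move-sign = solve-∀

-- Enumerating tournaments

∑-allVecs-suc : (n : ℕ) (f : Vec Bool (suc n) → ℤ) →
                ∑[ v ∈ allVecs (suc n) ] f v ≡ ∑[ w ∈ allVecs n ] (f (true ∷ᵥ w) + f (false ∷ᵥ w))
∑-allVecs-suc n f = trans (∑ₗ-concatMap _ (allVecs n) f)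
                          (∑ₗ-cong (allVecs n) (λ w → cong (_+_ (f (true ∷ᵥ w))) (ℤ.+-identityʳ _)))

∑-allTours-suc : (n : ℕ) (f : Tour (suc n) → ℤ) →
                 ∑[ T ∈ allTours (suc n) ] f T ≡ ∑[ v ∈ allVecs n ] ∑[ t ∈ allTours n ] f (v , t)
∑-allTours-suc n f = trans (∑ₗ-concatMap _ (allVecs n) f)
                           (∑ₗ-cong (allVecs n) (λ v → ∑ₗ-map (v ,_) (allTours n) f))

∑-allVecs-const : (n : ℕ) (c : ℤ) → ∑[ v ∈ allVecs n ] c ≡ (+ 2) ^ n * c
∑-allVecs-const zero    c = trans (ℤ.+-identityʳ c) (sym (ℤ.*-identityˡ c))
∑-allVecs-const (suc n) c = begin
  ∑[ v ∈ allVecs (suc n) ] c            ≡⟨ ∑-allVecs-suc n (λ _ → c) ⟩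
  ∑[ w ∈ allVecs n ] (c + c)            ≡⟨ ∑-allVecs-const n (c + c) ⟩
  (+ 2) ^ n * (c + c)                   ≡⟨ double-assoc ((+ 2) ^ n) c ⟩
  + 2 * (+ 2) ^ n * c                   ∎
  where
  double-assoc : ∀ a c → a * (c + c) ≡ + 2 * a * c
  double-assoc = solve-∀

∑-allVecs-pm-orthogonal : (n : ℕ) (j : Fin n) (g : Fin n → ℤ) →
  ∑[ v ∈ allVecs n ] (pm (lookup v j) * ∑[ a < n ] (pm (lookup v a) * g a)) ≡ (+ 2) ^ n * g j
∑-allVecs-pm-orthogonal (suc n) zero g = begin
  ∑[ v ∈ allVecs (suc n) ] (pm (lookup v zero) * ∑[ a < suc n ] (pm (lookup v a) * g a))
    ≡⟨ ∑-allVecs-suc n _ ⟩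
  ∑[ w ∈ allVecs n ] (+ 1 * (+ 1 * g zero + S w) + - + 1 * (- + 1 * g zero + S w))
    ≡⟨ ∑ₗ-cong (allVecs n) (λ w → cancel (g zero) (S w)) ⟩
  ∑[ w ∈ allVecs n ] (g zero + g zero)
    ≡⟨ ∑-allVecs-suc n (λ _ → g zero) ⟨
  ∑[ v ∈ allVecs (suc n) ] g zero
    ≡⟨ ∑-allVecs-const (suc n) (g zero) ⟩
  (+ 2) ^ suc n * g zero
    ∎
  where
  S : Vec Bool n → ℤ
  S w = ∑[ a < n ] (pm (lookup w a) * g (suc a))
  cancel : ∀ x y → + 1 * (+ 1 * x + y) + - + 1 * (- + 1 * x + y) ≡ x + x
  cancel = solve-∀
∑-allVecs-pm-orthogonal (suc n) (suc j) g = begin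
  ∑[ v ∈ allVecs (suc n) ] (pm (lookup v (suc j)) * ∑[ a < suc n ] (pm (lookup v a) * g a))
    ≡⟨ ∑-allVecs-suc n _ ⟩
  ∑[ w ∈ allVecs n ] (pm (lookup w j) * (+ 1 * g zero + S w) + pm (lookup w j) * (- + 1 * g zero + S w))
    ≡⟨ ∑ₗ-cong (allVecs n) (λ w → cancel (pm (lookup w j)) (g zero) (S w)) ⟩
  ∑[ w ∈ allVecs n ] (+ 2 * (pm (lookup w j) * S w))
    ≡⟨ *-distribˡ-∑ₗ (+ 2) (allVecs n) _ ⟨
  + 2 * ∑[ w ∈ allVecs n ] (pm (lookup w j) * S w)
    ≡⟨ cong (+ 2 *_) (∑-allVecs-pm-orthogonal n j (λ a → g (suc a))) ⟩
  + 2 * ((+ 2) ^ n * g (suc j))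
    ≡⟨ ℤ.*-assoc (+ 2) ((+ 2) ^ n) (g (suc j)) ⟨
  (+ 2) ^ suc n * g (suc j)
    ∎
  where
  S : Vec Bool n → ℤ
  S w = ∑[ a < n ] (pm (lookup w a) * g (suc a))
  cancel : ∀ s x y → s * (+ 1 * x + y) + s * (- + 1 * x + y) ≡ + 2 * (s * y)
  cancel = solve-∀

-- Splitting off vertex j: its incidences with the other vertices (indexed through punchIn j)
-- and the tournament on the remaining vertices.
star : {n : ℕ} → Fin (suc n) → Tour (suc n) → Vec Bool n
star zero    (v , t)         = v
star {suc n} (suc j) (v , t) = lookup v j ∷ᵥ star j t

delete : {n : ℕ} → Fin (suc n) → Tour (suc n) → Tour n
delete zero    (v , t)         = t
delete {suc n} (suc j) (v , t) = removeAt v j , delete j t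

lookup-removeAt : (v : Vec A (suc n)) (j : Fin (suc n)) (u : Fin n) →
                  lookup (removeAt v j) u ≡ lookup v (punchIn j u)
lookup-removeAt (x ∷ᵥ v)         zero    u       = refl
lookup-removeAt (x ∷ᵥ (y ∷ᵥ v)) (suc j) zero    = refl
lookup-removeAt (x ∷ᵥ (y ∷ᵥ v)) (suc j) (suc u) = lookup-removeAt (y ∷ᵥ v) j u

removeAt-∷ : (x : A) (v : Vec A (suc n)) (j : Fin (suc n)) →
             removeAt (x ∷ᵥ v) (suc j) ≡ x ∷ᵥ removeAt v j
removeAt-∷ x (y ∷ᵥ v) j = refl

∑-allVecs-lookup-removeAt : (n : ℕ) (j : Fin (suc n)) (F : Bool → Vec Bool n → ℤ) →
  ∑[ v ∈ allVecs (suc n) ] F (lookup v j) (removeAt v j) ≡ ∑[ w ∈ allVecs n ] (F true w + F false w)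
∑-allVecs-lookup-removeAt n       zero    F = ∑-allVecs-suc n (λ v → F (lookup v zero) (removeAt v zero))
∑-allVecs-lookup-removeAt (suc n) (suc j) F = begin
  ∑[ v ∈ allVecs (suc (suc n)) ] F (lookup v (suc j)) (removeAt v (suc j))
    ≡⟨ ∑-allVecs-suc (suc n) _ ⟩
  ∑[ w ∈ allVecs (suc n) ] (F (lookup w j) (removeAt (true ∷ᵥ w) (suc j)) + F (lookup w j) (removeAt (false ∷ᵥ w) (suc j)))
    ≡⟨ ∑ₗ-cong (allVecs (suc n)) (λ w → cong₂ _+_ (cong (F (lookup w j)) (removeAt-∷ true w j))
                                                   (cong (F (lookup w j)) (removeAt-∷ false w j))) ⟩
  ∑[ w ∈ allVecs (suc n) ] (F (lookup w j) (true ∷ᵥ removeAt w j) + F (lookup w j) (false ∷ᵥ removeAt w j))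
    ≡⟨ ∑ₗ-distrib-+ (allVecs (suc n)) _ _ ⟩
  ∑[ w ∈ allVecs (suc n) ] F (lookup w j) (true ∷ᵥ removeAt w j)
    + ∑[ w ∈ allVecs (suc n) ] F (lookup w j) (false ∷ᵥ removeAt w j)
    ≡⟨ cong₂ _+_ (∑-allVecs-lookup-removeAt n j (λ b u → F b (true ∷ᵥ u)))
                 (∑-allVecs-lookup-removeAt n j (λ b u → F b (false ∷ᵥ u))) ⟩
  ∑[ u ∈ allVecs n ] (F true (true ∷ᵥ u) + F false (true ∷ᵥ u))
    + ∑[ u ∈ allVecs n ] (F true (false ∷ᵥ u) + F false (false ∷ᵥ u))
    ≡⟨ ∑ₗ-distrib-+ (allVecs n) _ _ ⟨
  ∑[ u ∈ allVecs n ] ((F true (true ∷ᵥ u) + F false (true ∷ᵥ u)) + (F true (false ∷ᵥ u) + F false (false ∷ᵥ u)))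
    ≡⟨ ∑-allVecs-suc n (λ w → F true w + F false w) ⟨
  ∑[ w ∈ allVecs (suc n) ] (F true w + F false w)
    ∎

-- T ↦ (star j T , delete j T) is a bijection from Tour (suc n) onto Vec Bool n × Tour n.
∑-allTours-star-delete : (n : ℕ) (j : Fin (suc n)) (W : Vec Bool n → ℤ) (g : Tour n → ℤ) →
  ∑[ T ∈ allTours (suc n) ] (W (star j T) * g (delete j T)) ≡ ∑ₗ (allVecs n) W * ∑ₗ (allTours n) g
∑-allTours-star-delete n zero W g = begin
  ∑[ T ∈ allTours (suc n) ] (W (star zero T) * g (delete zero T))
    ≡⟨ ∑-allTours-suc n _ ⟩
  ∑[ v ∈ allVecs n ] ∑[ t ∈ allTours n ] (W v * g t)
    ≡⟨ ∑ₗ-cong (allVecs n) (λ v → *-distribˡ-∑ₗ (W v) (allTours n) g) ⟨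
  ∑[ v ∈ allVecs n ] (W v * ∑ₗ (allTours n) g)
    ≡⟨ *-distribʳ-∑ₗ _ (allVecs n) W ⟨
  ∑ₗ (allVecs n) W * ∑ₗ (allTours n) g
    ∎
∑-allTours-star-delete (suc n) (suc j) W g = begin
  ∑[ T ∈ allTours (suc (suc n)) ] (W (star (suc j) T) * g (delete (suc j) T))
    ≡⟨ ∑-allTours-suc (suc n) _ ⟩
  ∑[ v ∈ allVecs (suc n) ] ∑[ t ∈ allTours (suc n) ] (W (lookup v j ∷ᵥ star j t) * g (removeAt v j , delete j t))
    ≡⟨ ∑ₗ-cong (allVecs (suc n)) (λ v → ∑-allTours-star-delete n j (λ s → W (lookup v j ∷ᵥ s)) (λ t → g (removeAt v j , t))) ⟩
  ∑[ v ∈ allVecs (suc n) ] (Wᵇ (lookup v j) * G (removeAt v j))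
    ≡⟨ ∑-allVecs-lookup-removeAt n j (λ b w → Wᵇ b * G w) ⟩
  ∑[ w ∈ allVecs n ] (Wᵇ true * G w + Wᵇ false * G w)
    ≡⟨ ∑ₗ-cong (allVecs n) (λ w → ℤ.*-distribʳ-+ (G w) (Wᵇ true) (Wᵇ false)) ⟨
  ∑[ w ∈ allVecs n ] ((Wᵇ true + Wᵇ false) * G w)
    ≡⟨ *-distribˡ-∑ₗ (Wᵇ true + Wᵇ false) (allVecs n) G ⟨
  (Wᵇ true + Wᵇ false) * ∑ₗ (allVecs n) G
    ≡⟨ cong₂ _*_ (trans (∑-allVecs-suc n W) (∑ₗ-distrib-+ (allVecs n) _ _)) (∑-allTours-suc n g) ⟨
  ∑ₗ (allVecs (suc n)) W * ∑ₗ (allTours (suc n)) g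
    ∎
  where
  Wᵇ : Bool → ℤ
  Wᵇ b = ∑[ s ∈ allVecs n ] W (b ∷ᵥ s)
  G : Vec Bool n → ℤ
  G w = ∑[ t ∈ allTours n ] g (w , t)

∑-allTours-delete : (n : ℕ) (j : Fin (suc n)) (g : Tour n → ℤ) →
                    ∑[ T ∈ allTours (suc n) ] g (delete j T) ≡ (+ 2) ^ n * ∑ₗ (allTours n) g
∑-allTours-delete n j g = begin
  ∑[ T ∈ allTours (suc n) ] g (delete j T)           ≡⟨ ∑ₗ-cong (allTours (suc n)) (λ T → ℤ.*-identityˡ (g (delete j T))) ⟨
  ∑[ T ∈ allTours (suc n) ] (+ 1 * g (delete j T))   ≡⟨ ∑-allTours-star-delete n j (λ _ → + 1) g ⟩
  ∑[ v ∈ allVecs n ] (+ 1) * ∑ₗ (allTours n) g       ≡⟨ cong (_* ∑ₗ (allTours n) g) (∑-allVecs-const n (+ 1)) ⟩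
  (+ 2) ^ n * + 1 * ∑ₗ (allTours n) g                ≡⟨ cong (_* ∑ₗ (allTours n) g) (ℤ.*-identityʳ ((+ 2) ^ n)) ⟩
  (+ 2) ^ n * ∑ₗ (allTours n) g                      ∎

seidel-delete : {n : ℕ} (j : Fin (suc n)) (T : Tour (suc n)) (a b : Fin n) →
                seidel (delete j T) a b ≡ seidel T (punchIn j a) (punchIn j b)
seidel-delete         zero    (v , t) a       b       = refl
seidel-delete {suc n} (suc j) (v , t) zero    zero    = refl
seidel-delete {suc n} (suc j) (v , t) zero    (suc b) = cong pm (lookup-removeAt v j b)
seidel-delete {suc n} (suc j) (v , t) (suc a) zero    = cong (λ x → - pm x) (lookup-removeAt v j a)
seidel-delete {suc n} (suc j) (v , t) (suc a) (suc b) = seidel-delete j t a b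

-- The characteristic polynomial summed over all tournaments

charMatrix : {n : ℕ} → (Fin n → Fin n → ℤ) → Fin n → Fin n → Poly
charMatrix S i j = (if does (i ≟ j) then (+ 0 ∷ + 1 ∷ []) else []) ⊕ (- S i j ∷ [])

totalCoeff : ℕ → ℕ → ℤ
totalCoeff n i = ∑[ T ∈ allTours n ] coeff (charPoly n (seidel T)) i

charMatrix-delete : {n : ℕ} (j : Fin (suc n)) (T : Tour (suc n)) (x y : Fin n) →
  minor (charMatrix (seidel T)) j j x y ≡ charMatrix (seidel (delete j T)) x y
charMatrix-delete j T x y = cong₂ (λ b s → (if b then (+ 0 ∷ + 1 ∷ []) else []) ⊕ (- s ∷ []))
  (does-⇔ (mk⇔ (punchIn-injective j x y) (cong (punchIn j))) (punchIn j x ≟ punchIn j y) (x ≟ y))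
  (sym (seidel-delete j T x y))

sgn² : (m : ℕ) → sgn m * sgn m ≡ + 1
sgn² zero    = refl
sgn² (suc m) = trans (neg-square (sgn m)) (sgn² m)
  where
  neg-square : ∀ a → - a * - a ≡ a * a
  neg-square = solve-∀

minorCoeff : {m : ℕ} → Tour (suc m) → ℕ → Fin (suc m) → Fin (suc m) → ℤ
minorCoeff {m} t i a j = coeff (det m (minor (charMatrix (seidel t)) a j)) i

-- Expand det (xI − S) along row 0, then each minor of an entry of row 0 along its column 0.
coeff-charPoly-expand : (m : ℕ) (v : Vec Bool (suc m)) (t : Tour (suc m)) (i : ℕ) →
  coeff (charPoly (suc (suc m)) (seidel {suc (suc m)} (v , t))) i ≡
  shift (coeff (charPoly (suc m) (seidel t))) i
    + ∑[ j < suc m ] (sgn (toℕ j) * (pm (lookup v j) * ∑[ a < suc m ] (pm (lookup v a) * (sgn (toℕ a) * minorCoeff t i a j))))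
coeff-charPoly-expand m v t i = begin
  coeff (det (suc (suc m)) M) i
    ≡⟨ coeff-det (suc m) M i ⟩
  + 1 * coeff ((+ 0 ∷ + 1 ∷ []) ⊗ charPoly (suc m) (seidel t)) i
    + ∑[ j < suc m ] (- sgn (toℕ j) * coeff ((- pm (lookup v j) ∷ []) ⊗ det (suc m) (minor M zero (suc j))) i)
    ≡⟨ cong₂ _+_ (trans (ℤ.*-identityˡ _) (coeff-x-⊗ (charPoly (suc m) (seidel t)) i))
                 (sum-cong-≗ {suc m} (λ j → cong (- sgn (toℕ j) *_) (row₀-term j))) ⟩
  shift (coeff (charPoly (suc m) (seidel t))) i
    + ∑[ j < suc m ] (- sgn (toℕ j) * (- pm (lookup v j) * ∑[ a < suc m ] (sgn (toℕ a) * - - pm (lookup v a) * minorCoeff t i a j)))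
    ≡⟨ cong (_+_ (shift (coeff (charPoly (suc m) (seidel t))) i)) (sum-cong-≗ {suc m} normalise) ⟩
  shift (coeff (charPoly (suc m) (seidel t))) i
    + ∑[ j < suc m ] (sgn (toℕ j) * (pm (lookup v j) * ∑[ a < suc m ] (pm (lookup v a) * (sgn (toℕ a) * minorCoeff t i a j))))
    ∎
  where
  M : Fin (suc (suc m)) → Fin (suc (suc m)) → Poly
  M = charMatrix (seidel {suc (suc m)} (v , t))

  row₀-term : ∀ j → coeff ((- pm (lookup v j) ∷ []) ⊗ det (suc m) (minor M zero (suc j))) i ≡
                    - pm (lookup v j) * ∑[ a < suc m ] (sgn (toℕ a) * - - pm (lookup v a) * minorCoeff t i a j)
  row₀-term j = trans (coeff-const-⊗ (- pm (lookup v j)) (det (suc m) (minor M zero (suc j))) i)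
    (cong (- pm (lookup v j) *_) (det-expand-col₀ m (minor M zero (suc j)) (λ a → - - pm (lookup v a)) (λ a → refl) i))

  normalise : ∀ j →
    - sgn (toℕ j) * (- pm (lookup v j) * ∑[ a < suc m ] (sgn (toℕ a) * - - pm (lookup v a) * minorCoeff t i a j)) ≡
    sgn (toℕ j) * (pm (lookup v j) * ∑[ a < suc m ] (pm (lookup v a) * (sgn (toℕ a) * minorCoeff t i a j)))
  normalise j = trans (cancel-negs (sgn (toℕ j)) (pm (lookup v j)) _)
    (cong (λ z → sgn (toℕ j) * (pm (lookup v j) * z))
          (sum-cong-≗ {suc m} (λ a → reorder (sgn (toℕ a)) (pm (lookup v a)) (minorCoeff t i a j))))
    where
    cancel-negs : ∀ s p x → - s * (- p * x) ≡ s * (p * x)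
    cancel-negs = solve-∀
    reorder : ∀ s p e → s * - - p * e ≡ p * (s * e)
    reorder = solve-∀

-- Summing over the orientations of the edges at vertex 0 kills the terms with a ≠ j.
∑-allVecs-charPoly : (m : ℕ) (t : Tour (suc m)) (i : ℕ) →
  ∑[ v ∈ allVecs (suc m) ] coeff (charPoly (suc (suc m)) (seidel {suc (suc m)} (v , t))) i ≡
  (+ 2) ^ suc m * (shift (coeff (charPoly (suc m) (seidel t))) i + ∑[ j < suc m ] minorCoeff t i j j)
∑-allVecs-charPoly m t i = begin
  ∑[ v ∈ allVecs (suc m) ] coeff (charPoly (suc (suc m)) (seidel {suc (suc m)} (v , t))) i
    ≡⟨ ∑ₗ-cong (allVecs (suc m)) (λ v → coeff-charPoly-expand m v t i) ⟩
  ∑[ v ∈ allVecs (suc m) ] (X + ∑[ j < suc m ] F v j)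
    ≡⟨ ∑ₗ-distrib-+ (allVecs (suc m)) (λ _ → X) _ ⟩
  ∑[ v ∈ allVecs (suc m) ] X + ∑[ v ∈ allVecs (suc m) ] ∑[ j < suc m ] F v j
    ≡⟨ cong₂ _+_ (∑-allVecs-const (suc m) X) (∑ₗ-∑-comm (allVecs (suc m)) (suc m) F) ⟩
  P * X + ∑[ j < suc m ] ∑[ v ∈ allVecs (suc m) ] F v j
    ≡⟨ cong (_+_ (P * X)) (sum-cong-≗ {suc m} average) ⟩
  P * X + ∑[ j < suc m ] (P * minorCoeff t i j j)
    ≡⟨ cong (_+_ (P * X)) (*-distribˡ-sum {suc m} P (λ j → minorCoeff t i j j)) ⟨
  P * X + P * ∑[ j < suc m ] minorCoeff t i j j
    ≡⟨ ℤ.*-distribˡ-+ P X _ ⟨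
  P * (X + ∑[ j < suc m ] minorCoeff t i j j)
    ∎
  where
  P : ℤ
  P = (+ 2) ^ suc m
  X : ℤ
  X = shift (coeff (charPoly (suc m) (seidel t))) i
  F : Vec Bool (suc m) → Fin (suc m) → ℤ
  F v j = sgn (toℕ j) * (pm (lookup v j) * ∑[ a < suc m ] (pm (lookup v a) * (sgn (toℕ a) * minorCoeff t i a j)))

  average : ∀ j → ∑[ v ∈ allVecs (suc m) ] F v j ≡ P * minorCoeff t i j j
  average j = begin
    ∑[ v ∈ allVecs (suc m) ] F v j
      ≡⟨ *-distribˡ-∑ₗ (sgn (toℕ j)) (allVecs (suc m)) _ ⟨
    sgn (toℕ j) * ∑[ v ∈ allVecs (suc m) ] (pm (lookup v j) * ∑[ a < suc m ] (pm (lookup v a) * (sgn (toℕ a) * minorCoeff t i a j)))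
      ≡⟨ cong (sgn (toℕ j) *_) (∑-allVecs-pm-orthogonal (suc m) j (λ a → sgn (toℕ a) * minorCoeff t i a j)) ⟩
    sgn (toℕ j) * (P * (sgn (toℕ j) * minorCoeff t i j j))
      ≡⟨ square-out (sgn (toℕ j)) P (minorCoeff t i j j) ⟩
    sgn (toℕ j) * sgn (toℕ j) * (P * minorCoeff t i j j)
      ≡⟨ cong (_* (P * minorCoeff t i j j)) (sgn² (toℕ j)) ⟩
    + 1 * (P * minorCoeff t i j j)
      ≡⟨ ℤ.*-identityˡ _ ⟩
    P * minorCoeff t i j j
      ∎
    where
    square-out : ∀ s p e → s * (p * (s * e)) ≡ s * s * (p * e)
    square-out = solve-∀

∑-allTours-minorCoeff : (m : ℕ) (j : Fin (suc m)) (i : ℕ) →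
  ∑[ t ∈ allTours (suc m) ] minorCoeff t i j j ≡ (+ 2) ^ m * totalCoeff m i
∑-allTours-minorCoeff m j i =
  trans (∑ₗ-cong (allTours (suc m)) (λ t → cong (λ p → coeff p i) (det-cong m (charMatrix-delete j t))))
        (∑-allTours-delete m j (λ t → coeff (charPoly m (seidel t)) i))

totalCoeff-suc-suc : (m i : ℕ) →
  totalCoeff (suc (suc m)) i ≡ (+ 2) ^ suc m * (shift (totalCoeff (suc m)) i + + suc m * ((+ 2) ^ m * totalCoeff m i))
totalCoeff-suc-suc m i = begin
  totalCoeff (suc (suc m)) i
    ≡⟨ ∑-allTours-suc (suc m) _ ⟩
  ∑[ v ∈ allVecs (suc m) ] ∑[ t ∈ allTours (suc m) ] c₂ (v , t)
    ≡⟨ ∑ₗ-comm (allVecs (suc m)) (allTours (suc m)) (λ v t → c₂ (v , t)) ⟩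
  ∑[ t ∈ allTours (suc m) ] ∑[ v ∈ allVecs (suc m) ] c₂ (v , t)
    ≡⟨ ∑ₗ-cong (allTours (suc m)) (λ t → ∑-allVecs-charPoly m t i) ⟩
  ∑[ t ∈ allTours (suc m) ] ((+ 2) ^ suc m * (shift (c₁ t) i + ∑[ j < suc m ] minorCoeff t i j j))
    ≡⟨ *-distribˡ-∑ₗ ((+ 2) ^ suc m) (allTours (suc m)) _ ⟨
  (+ 2) ^ suc m * ∑[ t ∈ allTours (suc m) ] (shift (c₁ t) i + ∑[ j < suc m ] minorCoeff t i j j)
    ≡⟨ cong ((+ 2) ^ suc m *_) (∑ₗ-distrib-+ (allTours (suc m)) _ _) ⟩
  (+ 2) ^ suc m * (∑[ t ∈ allTours (suc m) ] shift (c₁ t) i + ∑[ t ∈ allTours (suc m) ] ∑[ j < suc m ] minorCoeff t i j j)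
    ≡⟨ cong ((+ 2) ^ suc m *_) (cong₂ _+_ (shift-∑ₗ (allTours (suc m)) c₁ i)
                                          (∑ₗ-∑-comm (allTours (suc m)) (suc m) (λ t j → minorCoeff t i j j))) ⟩
  (+ 2) ^ suc m * (shift (totalCoeff (suc m)) i + ∑[ j < suc m ] ∑[ t ∈ allTours (suc m) ] minorCoeff t i j j)
    ≡⟨ cong (λ z → (+ 2) ^ suc m * (shift (totalCoeff (suc m)) i + z))
            (trans (sum-cong-≗ {suc m} (λ j → ∑-allTours-minorCoeff m j i)) (∑-const (suc m) _)) ⟩
  (+ 2) ^ suc m * (shift (totalCoeff (suc m)) i + + suc m * ((+ 2) ^ m * totalCoeff m i))
    ∎
  where
  c₂ : Tour (suc (suc m)) → ℤ
  c₂ T = coeff (charPoly (suc (suc m)) (seidel T)) i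
  c₁ : Tour (suc m) → ℕ → ℤ
  c₁ t = coeff (charPoly (suc m) (seidel t))

-- The expected characteristic polynomial

[k+1]*[n+1]C[k+1]≡[n+1]*nCk : ∀ n k → suc k ℕ.* (suc n C suc k) ≡ suc n ℕ.* (n C k)
[k+1]*[n+1]C[k+1]≡[n+1]*nCk zero    zero    = refl
[k+1]*[n+1]C[k+1]≡[n+1]*nCk zero    (suc k) =
  trans (cong (suc (suc k) ℕ.*_) (k>n⇒nCk≡0 {1} {suc (suc k)} (s≤s (s≤s z≤n)))) (ℕ.*-zeroʳ (suc (suc k)))
[k+1]*[n+1]C[k+1]≡[n+1]*nCk (suc n) k = begin
  suc k ℕ.* (suc (suc n) C suc k)                          ≡⟨ cong (suc k ℕ.*_) (nCk+nC[k+1]≡[n+1]C[k+1] (suc n) k) ⟨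
  suc k ℕ.* (suc n C k ℕ.+ suc n C suc k)                  ≡⟨ ℕ.*-distribˡ-+ (suc k) (suc n C k) _ ⟩
  suc k ℕ.* (suc n C k) ℕ.+ suc k ℕ.* (suc n C suc k)      ≡⟨ cong (suc k ℕ.* (suc n C k) ℕ.+_) ([k+1]*[n+1]C[k+1]≡[n+1]*nCk n k) ⟩
  suc k ℕ.* (suc n C k) ℕ.+ suc n ℕ.* (n C k)              ≡⟨ absorb-lower k ⟩
  suc (suc n) ℕ.* (suc n C k)                              ∎
  where
  absorb-lower : ∀ k → suc k ℕ.* (suc n C k) ℕ.+ suc n ℕ.* (n C k) ≡ suc (suc n) ℕ.* (suc n C k)
  absorb-lower zero    = ℕ.solve-∀
  absorb-lower (suc k) = begin
    suc (suc k) ℕ.* (suc n C suc k) ℕ.+ suc n ℕ.* (n C suc k)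
      ≡⟨ cong (λ z → suc n C suc k ℕ.+ z ℕ.+ suc n ℕ.* (n C suc k)) ([k+1]*[n+1]C[k+1]≡[n+1]*nCk n k) ⟩
    suc n C suc k ℕ.+ suc n ℕ.* (n C k) ℕ.+ suc n ℕ.* (n C suc k)
      ≡⟨ ℕ.+-assoc (suc n C suc k) _ _ ⟩
    suc n C suc k ℕ.+ (suc n ℕ.* (n C k) ℕ.+ suc n ℕ.* (n C suc k))
      ≡⟨ cong (suc n C suc k ℕ.+_) (ℕ.*-distribˡ-+ (suc n) (n C k) (n C suc k)) ⟨
    suc n C suc k ℕ.+ suc n ℕ.* (n C k ℕ.+ n C suc k)
      ≡⟨ cong (λ z → suc n C suc k ℕ.+ suc n ℕ.* z) (nCk+nC[k+1]≡[n+1]C[k+1] n k) ⟩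
    suc (suc n) ℕ.* (suc n C suc k)
      ∎

oddDF-suc : ∀ k → oddDF (suc k) ≡ suc (2 ℕ.* k) ℕ.* oddDF k
oddDF-suc zero    = refl
oddDF-suc (suc k) = begin
  (2 ℕ.* suc (suc k) ∸ 1) !!   ≡⟨ cong (λ z → (z ∸ 1) !!) (ℕ.*-suc 2 (suc k)) ⟩
  suc (2 ℕ.* suc k) !!         ≡⟨ cong (λ z → suc z !!) (ℕ.*-suc 2 k) ⟩
  suc (suc (suc (2 ℕ.* k))) ℕ.* (suc (2 ℕ.* k) !!)
                               ≡⟨ cong₂ (λ a b → suc a ℕ.* b) (ℕ.*-suc 2 k) (cong (λ z → (z ∸ 1) !!) (ℕ.*-suc 2 k)) ⟨
  suc (2 ℕ.* suc k) ℕ.* oddDF (suc k) ∎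

pairings : ℕ → ℕ → ℕ
pairings n k = (n C (2 ℕ.* k)) ℕ.* oddDF k

-- Vertex 0 is either left out, or paired with one of the other m + 1 vertices.
pairings-suc-suc : ∀ m k → pairings (suc (suc m)) (suc k) ≡ pairings (suc m) (suc k) ℕ.+ suc m ℕ.* pairings m k
pairings-suc-suc m k = begin
  (suc (suc m) C (2 ℕ.* suc k)) ℕ.* oddDF (suc k)
    ≡⟨ cong₂ (λ a b → (suc (suc m) C a) ℕ.* b) (ℕ.*-suc 2 k) (oddDF-suc k) ⟩
  (suc (suc m) C suc (suc (2 ℕ.* k))) ℕ.* (suc (2 ℕ.* k) ℕ.* oddDF k)
    ≡⟨ cong (ℕ._* (suc (2 ℕ.* k) ℕ.* oddDF k)) (nCk+nC[k+1]≡[n+1]C[k+1] (suc m) (suc (2 ℕ.* k))) ⟨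
  (suc m C suc (2 ℕ.* k) ℕ.+ suc m C suc (suc (2 ℕ.* k))) ℕ.* (suc (2 ℕ.* k) ℕ.* oddDF k)
    ≡⟨ rearrange (suc m C suc (2 ℕ.* k)) (suc m C suc (suc (2 ℕ.* k))) (suc (2 ℕ.* k)) (oddDF k) ⟩
  (suc m C suc (suc (2 ℕ.* k))) ℕ.* (suc (2 ℕ.* k) ℕ.* oddDF k) ℕ.+ (suc (2 ℕ.* k) ℕ.* (suc m C suc (2 ℕ.* k))) ℕ.* oddDF k
    ≡⟨ cong₂ ℕ._+_ (cong₂ (λ a b → (suc m C a) ℕ.* b) (ℕ.*-suc 2 k) (oddDF-suc k))
                   (cong (ℕ._* oddDF k) (sym ([k+1]*[n+1]C[k+1]≡[n+1]*nCk m (2 ℕ.* k)))) ⟨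
  pairings (suc m) (suc k) ℕ.+ (suc m ℕ.* (m C (2 ℕ.* k))) ℕ.* oddDF k
    ≡⟨ cong (pairings (suc m) (suc k) ℕ.+_) (ℕ.*-assoc (suc m) (m C (2 ℕ.* k)) (oddDF k)) ⟩
  pairings (suc m) (suc k) ℕ.+ suc m ℕ.* pairings m k
    ∎
  where
  rearrange : ∀ a b c d → (a ℕ.+ b) ℕ.* (c ℕ.* d) ≡ b ℕ.* (c ℕ.* d) ℕ.+ (c ℕ.* a) ℕ.* d
  rearrange = ℕ.solve-∀

pairings-vanish : ∀ n k → n < 2 ℕ.* k → pairings n k ≡ 0
pairings-vanish n k n<2k = cong (ℕ._* _) (k>n⇒nCk≡0 n<2k)

coeff-monomial-+ : (d : ℕ) (a b : ℤ) (i : ℕ) →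
                   coeff (monomial d (a + b)) i ≡ coeff (monomial d a) i + coeff (monomial d b) i
coeff-monomial-+ zero    a b zero    = refl
coeff-monomial-+ zero    a b (suc i) = refl
coeff-monomial-+ (suc d) a b zero    = refl
coeff-monomial-+ (suc d) a b (suc i) = coeff-monomial-+ d a b i

coeff-monomial-* : (d : ℕ) (c a : ℤ) (i : ℕ) → coeff (monomial d (c * a)) i ≡ c * coeff (monomial d a) i
coeff-monomial-* zero    c a zero    = refl
coeff-monomial-* zero    c a (suc i) = sym (ℤ.*-zeroʳ c)
coeff-monomial-* (suc d) c a zero    = sym (ℤ.*-zeroʳ c)
coeff-monomial-* (suc d) c a (suc i) = coeff-monomial-* d c a i

coeff-monomial-0 : (d i : ℕ) → coeff (monomial d (+ 0)) i ≡ + 0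
coeff-monomial-0 zero    zero    = refl
coeff-monomial-0 zero    (suc i) = refl
coeff-monomial-0 (suc d) zero    = refl
coeff-monomial-0 (suc d) (suc i) = coeff-monomial-0 d i

coeff-monomial-≢ : {d i : ℕ} (c : ℤ) → ¬ d ≡ i → coeff (monomial d c) i ≡ + 0
coeff-monomial-≢ {zero}  {zero}  c d≢i = contradiction refl d≢i
coeff-monomial-≢ {zero}  {suc i} c d≢i = refl
coeff-monomial-≢ {suc d} {zero}  c d≢i = refl
coeff-monomial-≢ {suc d} {suc i} c d≢i = coeff-monomial-≢ c (λ d≡i → d≢i (cong suc d≡i))

coeff-monomial-≡ : (d : ℕ) (c : ℤ) → coeff (monomial d c) d ≡ c
coeff-monomial-≡ zero    c = refl
coeff-monomial-≡ (suc d) c = coeff-monomial-≡ d c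

shift-monomial : (d : ℕ) (c : ℤ) (i : ℕ) → shift (coeff (monomial d c)) i ≡ coeff (monomial (suc d) c) i
shift-monomial d c zero    = refl
shift-monomial d c (suc i) = refl

expectedTerm : ℕ → ℕ → ℕ → ℤ
expectedTerm n i k = coeff (monomial (n ∸ 2 ℕ.* k) (+ pairings n k)) i

partialCoeff : ℕ → ℕ → ℕ → ℤ
partialCoeff n L i = ∑[ k < L ] expectedTerm n i (toℕ k)

coeff-expectedCharPoly : (n i : ℕ) → coeff (expectedCharPoly n) i ≡ partialCoeff n (suc (n / 2)) i
coeff-expectedCharPoly n i = trans (coeff-sumP (upTo (suc (n / 2))) (λ k → monomial (n ∸ 2 ℕ.* k) (+ pairings n k)) i)
                                   (∑ₗ-applyUpTo (λ k → k) (suc (n / 2)) (expectedTerm n i))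

partialCoeff-extend : ∀ n L d i → n < 2 ℕ.* L → partialCoeff n (L ℕ.+ d) i ≡ partialCoeff n L i
partialCoeff-extend n L zero    i n<2L = cong (λ l → partialCoeff n l i) (ℕ.+-identityʳ L)
partialCoeff-extend n L (suc d) i n<2L = begin
  partialCoeff n (L ℕ.+ suc d) i                              ≡⟨ cong (λ l → partialCoeff n l i) (ℕ.+-suc L d) ⟩
  partialCoeff n (suc (L ℕ.+ d)) i                            ≡⟨ ∑-toℕ-last (L ℕ.+ d) (expectedTerm n i) ⟩
  partialCoeff n (L ℕ.+ d) i + expectedTerm n i (L ℕ.+ d)     ≡⟨ cong (_+_ (partialCoeff n (L ℕ.+ d) i)) vanish ⟩
  partialCoeff n (L ℕ.+ d) i + + 0                            ≡⟨ ℤ.+-identityʳ _ ⟩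
  partialCoeff n (L ℕ.+ d) i                                  ≡⟨ partialCoeff-extend n L d i n<2L ⟩
  partialCoeff n L i                                          ∎
  where
  vanish : expectedTerm n i (L ℕ.+ d) ≡ + 0
  vanish = trans (cong (λ p → coeff (monomial (n ∸ 2 ℕ.* (L ℕ.+ d)) (+ p)) i)
                       (pairings-vanish n (L ℕ.+ d) (ℕ.<-≤-trans n<2L (ℕ.*-monoʳ-≤ 2 (ℕ.m≤m+n L d)))))
                 (coeff-monomial-0 (n ∸ 2 ℕ.* (L ℕ.+ d)) i)

partialCoeff-stable : ∀ n L L′ i → n < 2 ℕ.* L → n < 2 ℕ.* L′ → partialCoeff n L i ≡ partialCoeff n L′ i
partialCoeff-stable n L L′ i n<2L n<2L′ = begin
  partialCoeff n L i            ≡⟨ partialCoeff-extend n L L′ i n<2L ⟨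
  partialCoeff n (L ℕ.+ L′) i   ≡⟨ cong (λ l → partialCoeff n l i) (ℕ.+-comm L L′) ⟩
  partialCoeff n (L′ ℕ.+ L) i   ≡⟨ partialCoeff-extend n L′ L i n<2L′ ⟩
  partialCoeff n L′ i           ∎

n<2[1+n/2] : ∀ n → n < 2 ℕ.* suc (n / 2)
n<2[1+n/2] n = subst₂ _<_ (sym (ℕ.m≡m%n+[m/n]*n n 2)) (ℕ.*-comm (suc (n / 2)) 2)
                       (ℕ.+-monoˡ-< (n / 2 ℕ.* 2) (ℕ.m%n<n n 2))

n≤L⇒n<2[1+L] : ∀ {n L} → n ≤ L → n < 2 ℕ.* suc L
n≤L⇒n<2[1+L] {n} {L} n≤L = ℕ.≤-trans (s≤s n≤L) (ℕ.m≤m+n (suc L) _)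

coeff-expectedCharPoly-partial : ∀ n L i → n < 2 ℕ.* L → coeff (expectedCharPoly n) i ≡ partialCoeff n L i
coeff-expectedCharPoly-partial n L i n<2L =
  trans (coeff-expectedCharPoly n i) (partialCoeff-stable n (suc (n / 2)) L i (n<2[1+n/2] n) n<2L)

shift-expectedTerm : ∀ m k i →
  shift (λ j → expectedTerm (suc m) j (suc k)) i ≡ coeff (monomial (m ∸ 2 ℕ.* k) (+ pairings (suc m) (suc k))) i
shift-expectedTerm m k i with m ∸ 2 ℕ.* k in m∸2k≡
... | suc d = begin
  shift (λ j → coeff (monomial (suc m ∸ 2 ℕ.* suc k) c) j) i  ≡⟨ shift-cong (λ j → cong (λ e → coeff (monomial e c) j) exponent) i ⟩
  shift (coeff (monomial d c)) i                              ≡⟨ shift-monomial d c i ⟩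
  coeff (monomial (suc d) c) i                                ∎
  where
  c : ℤ
  c = + pairings (suc m) (suc k)
  exponent : suc m ∸ 2 ℕ.* suc k ≡ d
  exponent = trans (cong (suc m ∸_) (ℕ.*-suc 2 k)) (trans (sym (ℕ.pred[m∸n]≡m∸[1+n] m (2 ℕ.* k))) (cong ℕ.pred m∸2k≡))
... | zero = begin
  shift (λ j → coeff (monomial (suc m ∸ 2 ℕ.* suc k) (+ pairings (suc m) (suc k))) j) i
    ≡⟨ shift-cong (λ j → trans (cong (λ p → coeff (monomial (suc m ∸ 2 ℕ.* suc k) (+ p)) j) vanish)
                               (coeff-monomial-0 (suc m ∸ 2 ℕ.* suc k) j)) i ⟩
  shift (λ _ → + 0) i
    ≡⟨ shift-* (+ 0) (λ _ → + 0) i ⟩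
  + 0
    ≡⟨ trans (cong (λ p → coeff (monomial 0 (+ p)) i) vanish) (coeff-monomial-0 0 i) ⟨
  coeff (monomial 0 (+ pairings (suc m) (suc k))) i
    ∎
  where
  vanish : pairings (suc m) (suc k) ≡ 0
  vanish = pairings-vanish (suc m) (suc k) (subst (suc m <_) (sym (ℕ.*-suc 2 k)) (s≤s (s≤s (ℕ.m∸n≡0⇒m≤n m∸2k≡))))

expectedTerm-suc-suc : ∀ m k i →
  expectedTerm (suc (suc m)) i (suc k) ≡
  shift (λ j → expectedTerm (suc m) j (suc k)) i + + suc m * expectedTerm m i k
expectedTerm-suc-suc m k i = begin
  coeff (monomial (suc (suc m) ∸ 2 ℕ.* suc k) (+ pairings (suc (suc m)) (suc k))) i
    ≡⟨ cong₂ (λ e p → coeff (monomial e (+ p)) i) (cong (suc (suc m) ∸_) (ℕ.*-suc 2 k)) (pairings-suc-suc m k) ⟩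
  coeff (monomial (m ∸ 2 ℕ.* k) (+ (p₁ ℕ.+ suc m ℕ.* p₀))) i
    ≡⟨ cong (λ c → coeff (monomial (m ∸ 2 ℕ.* k) c) i) (trans (ℤ.pos-+ p₁ _) (cong (_+_ (+ p₁)) (ℤ.pos-* (suc m) p₀))) ⟩
  coeff (monomial (m ∸ 2 ℕ.* k) (+ p₁ + + suc m * + p₀)) i
    ≡⟨ coeff-monomial-+ (m ∸ 2 ℕ.* k) (+ p₁) _ i ⟩
  coeff (monomial (m ∸ 2 ℕ.* k) (+ p₁)) i + coeff (monomial (m ∸ 2 ℕ.* k) (+ suc m * + p₀)) i
    ≡⟨ cong₂ _+_ (shift-expectedTerm m k i) (sym (coeff-monomial-* (m ∸ 2 ℕ.* k) (+ suc m) (+ p₀) i)) ⟨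
  shift (λ j → expectedTerm (suc m) j (suc k)) i + + suc m * expectedTerm m i k
    ∎
  where
  p₁ p₀ : ℕ
  p₁ = pairings (suc m) (suc k)
  p₀ = pairings m k

partialCoeff-suc-suc : ∀ m L i →
  partialCoeff (suc (suc m)) (suc L) i ≡ shift (partialCoeff (suc m) (suc L)) i + + suc m * partialCoeff m L i
partialCoeff-suc-suc m L i = begin
  t₀ + ∑[ k < L ] expectedTerm (suc (suc m)) i (suc (toℕ k))
    ≡⟨ cong (_+_ t₀) (sum-cong-≗ {L} (λ k → expectedTerm-suc-suc m (toℕ k) i)) ⟩
  t₀ + ∑[ k < L ] (shift (λ j → expectedTerm (suc m) j (suc (toℕ k))) i + + suc m * expectedTerm m i (toℕ k))
    ≡⟨ cong (_+_ t₀) (∑-distrib-+ {L} _ _) ⟩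
  t₀ + (∑[ k < L ] shift (λ j → expectedTerm (suc m) j (suc (toℕ k))) i + ∑[ k < L ] (+ suc m * expectedTerm m i (toℕ k)))
    ≡⟨ cong (λ z → t₀ + (∑[ k < L ] shift (λ j → expectedTerm (suc m) j (suc (toℕ k))) i + z))
            (*-distribˡ-sum {L} (+ suc m) (λ k → expectedTerm m i (toℕ k))) ⟨
  t₀ + (∑[ k < L ] shift (λ j → expectedTerm (suc m) j (suc (toℕ k))) i + + suc m * partialCoeff m L i)
    ≡⟨ ℤ.+-assoc t₀ _ _ ⟨
  t₀ + ∑[ k < L ] shift (λ j → expectedTerm (suc m) j (suc (toℕ k))) i + + suc m * partialCoeff m L i
    ≡⟨ cong (_+ + suc m * partialCoeff m L i) shift-partialCoeff ⟨
  shift (partialCoeff (suc m) (suc L)) i + + suc m * partialCoeff m L i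
    ∎
  where
  t₀ : ℤ
  t₀ = expectedTerm (suc (suc m)) i 0
  shift-partialCoeff : shift (partialCoeff (suc m) (suc L)) i ≡
                       t₀ + ∑[ k < L ] shift (λ j → expectedTerm (suc m) j (suc (toℕ k))) i
  shift-partialCoeff = trans (shift-+ (λ j → expectedTerm (suc m) j 0) _ i)
    (cong₂ _+_ (shift-monomial (suc m) (+ 1) i) (shift-∑ L (λ k j → expectedTerm (suc m) j (suc (toℕ k))) i))

coeff-expectedCharPoly-suc-suc : ∀ m i →
  coeff (expectedCharPoly (suc (suc m))) i ≡
  shift (coeff (expectedCharPoly (suc m))) i + + suc m * coeff (expectedCharPoly m) i
coeff-expectedCharPoly-suc-suc m i = begin
  coeff (expectedCharPoly (suc (suc m))) i
    ≡⟨ coeff-expectedCharPoly-partial (suc (suc m)) (suc (suc (suc m))) i (n≤L⇒n<2[1+L] ℕ.≤-refl) ⟩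
  partialCoeff (suc (suc m)) (suc (suc (suc m))) i
    ≡⟨ partialCoeff-suc-suc m (suc (suc m)) i ⟩
  shift (partialCoeff (suc m) (suc (suc (suc m)))) i + + suc m * partialCoeff m (suc (suc m)) i
    ≡⟨ cong₂ (λ a b → a + + suc m * b)
             (shift-cong (λ j → coeff-expectedCharPoly-partial (suc m) (suc (suc (suc m))) j
                                  (n≤L⇒n<2[1+L] (ℕ.n≤1+n _))) i)
             (coeff-expectedCharPoly-partial m (suc (suc m)) i (n≤L⇒n<2[1+L] (ℕ.n≤1+n _))) ⟨
  shift (coeff (expectedCharPoly (suc m))) i + + suc m * coeff (expectedCharPoly m) i
    ∎

coeff-expectedCharPoly-top : ∀ n k → k ≤ n / 2 → coeff (expectedCharPoly n) (n ∸ 2 ℕ.* k) ≡ + pairings n k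
coeff-expectedCharPoly-top n k k≤n/2 = begin
  coeff (expectedCharPoly n) (n ∸ 2 ℕ.* k)      ≡⟨ coeff-expectedCharPoly n (n ∸ 2 ℕ.* k) ⟩
  partialCoeff n (suc (n / 2)) (n ∸ 2 ℕ.* k)     ≡⟨ ∑-toℕ-δ (suc (n / 2)) (expectedTerm n (n ∸ 2 ℕ.* k)) k (s≤s k≤n/2) off-diagonal ⟩
  expectedTerm n (n ∸ 2 ℕ.* k) k                 ≡⟨ coeff-monomial-≡ (n ∸ 2 ℕ.* k) (+ pairings n k) ⟩
  + pairings n k                                 ∎
  where
  2[n/2]≤n : 2 ℕ.* (n / 2) ≤ n
  2[n/2]≤n = subst (_≤ n) (ℕ.*-comm (n / 2) 2) (ℕ.m/n*n≤m n 2)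
  2*≤n : ∀ {j} → j ≤ n / 2 → 2 ℕ.* j ≤ n
  2*≤n j≤n/2 = ℕ.≤-trans (ℕ.*-monoʳ-≤ 2 j≤n/2) 2[n/2]≤n
  off-diagonal : ∀ j → j < suc (n / 2) → ¬ j ≡ k → expectedTerm n (n ∸ 2 ℕ.* k) j ≡ + 0
  off-diagonal j (s≤s j≤n/2) j≢k = coeff-monomial-≢ (+ pairings n j)
    (λ eq → j≢k (ℕ.*-cancelˡ-≡ j k 2 (ℕ.∸-cancelˡ-≡ (2*≤n j≤n/2) (2*≤n k≤n/2) eq)))

-- Counting matchings

𝟙 : Bool → ℤ
𝟙 b = if b then + 1 else + 0

+countTrue≡∑𝟙 : (p : A → Bool) (xs : List A) → + countTrue (map p xs) ≡ ∑[ x ∈ xs ] 𝟙 (p x)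
+countTrue≡∑𝟙 p []       = refl
+countTrue≡∑𝟙 p (x ∷ xs) with p x
... | true  = cong (_+_ (+ 1)) (+countTrue≡∑𝟙 p xs)
... | false = trans (+countTrue≡∑𝟙 p xs) (sym (ℤ.+-identityˡ _))

bump : Bool → ℕ → ℕ
bump b m = if b then suc m else m

bump-comm : ∀ a b m → bump a (bump b m) ≡ bump b (bump a m)
bump-comm true  true  m = refl
bump-comm true  false m = refl
bump-comm false b     m = refl

bump-+ : ∀ b m k → bump b m ℕ.+ k ≡ bump b (m ℕ.+ k)
bump-+ true  m k = refl
bump-+ false m k = refl

∣_∣ : Vec Bool n → ℕ
∣ v ∣ = countTrue (toList v)

∣⊥∣≡0 : (n : ℕ) → ∣ ⊥ {n} ∣ ≡ 0
∣⊥∣≡0 zero    = refl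
∣⊥∣≡0 (suc n) = ∣⊥∣≡0 n

∣⁅j⁆∣≡1 : (j : Fin n) → ∣ ⁅ j ⁆ ∣ ≡ 1
∣⁅j⁆∣≡1 {suc n} zero    = cong suc (∣⊥∣≡0 n)
∣⁅j⁆∣≡1         (suc j) = ∣⁅j⁆∣≡1 j

lookup-⁅j⁆-j : (j : Fin n) → lookup ⁅ j ⁆ j ≡ true
lookup-⁅j⁆-j zero    = refl
lookup-⁅j⁆-j (suc j) = lookup-⁅j⁆-j j

lookup-⁅j⁆-punchIn : (j : Fin (suc n)) (u : Fin n) → lookup ⁅ j ⁆ (punchIn j u) ≡ false
lookup-⁅j⁆-punchIn         zero    u       = lookup-replicate u false
lookup-⁅j⁆-punchIn {suc n} (suc j) zero    = refl
lookup-⁅j⁆-punchIn {suc n} (suc j) (suc u) = lookup-⁅j⁆-punchIn j u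

∣v∣≡0⇒lookup≡false : (v : Vec Bool n) → ∣ v ∣ ≡ 0 → ∀ u → lookup v u ≡ false
∣v∣≡0⇒lookup≡false (false ∷ᵥ v) ∣v∣≡0 zero    = refl
∣v∣≡0⇒lookup≡false (false ∷ᵥ v) ∣v∣≡0 (suc u) = ∣v∣≡0⇒lookup≡false v ∣v∣≡0 u

∣v∣≡bump-removeAt : (v : Vec Bool (suc n)) (j : Fin (suc n)) → ∣ v ∣ ≡ bump (lookup v j) ∣ removeAt v j ∣
∣v∣≡bump-removeAt (b ∷ᵥ v)         zero    = refl
∣v∣≡bump-removeAt (b ∷ᵥ (c ∷ᵥ v)) (suc j) =
  trans (cong (bump b) (∣v∣≡bump-removeAt (c ∷ᵥ v) j)) (bump-comm b (lookup (c ∷ᵥ v) j) _)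

allFin-suc : (n : ℕ) → allFin (suc n) ≡ zero ∷ map suc (allFin n)
allFin-suc n = cong (zero ∷_) (sym (List.map-tabulate (λ i → i) suc))

map-lookup-allFin : (v : Vec A n) → map (lookup v) (allFin n) ≡ toList v
map-lookup-allFin []ᵥ            = refl
map-lookup-allFin {n = suc n} (x ∷ᵥ v) =
  trans (cong (map (lookup (x ∷ᵥ v))) (allFin-suc n)) (cong (x ∷_) (trans (sym (List.map-∘ (allFin n))) (map-lookup-allFin v)))

countTrue-map-allFin-suc : (f : Fin (suc n) → Bool) →
  countTrue (map f (allFin (suc n))) ≡ bump (f zero) (countTrue (map (f ∘ suc) (allFin n)))
countTrue-map-allFin-suc {n} f =
  trans (cong (countTrue ∘ map f) (allFin-suc n)) (cong (bump (f zero) ∘ countTrue) (sym (List.map-∘ (allFin n))))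

allB-cong : {p q : A → Bool} → (∀ x → p x ≡ q x) → (xs : List A) → allB p xs ≡ allB q xs
allB-cong p≗q []       = refl
allB-cong p≗q (x ∷ xs) = cong₂ _∧_ (p≗q x) (allB-cong p≗q xs)

allB-map : (p : B → Bool) (f : A → B) (xs : List A) → allB p (map f xs) ≡ allB (p ∘ f) xs
allB-map p f []       = refl
allB-map p f (x ∷ xs) = cong (p (f x) ∧_) (allB-map p f xs)

allB-allFin-suc : (p : Fin (suc n) → Bool) → allB p (allFin (suc n)) ≡ p zero ∧ allB (p ∘ suc) (allFin n)
allB-allFin-suc {n} p = trans (cong (allB p) (allFin-suc n)) (cong (p zero ∧_) (allB-map p suc (allFin n)))

allB-allFin-punchIn : (j : Fin (suc n)) (p : Fin (suc n) → Bool) →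
  allB p (allFin (suc n)) ≡ p j ∧ allB (p ∘ punchIn j) (allFin n)
allB-allFin-punchIn         zero    p = allB-allFin-suc p
allB-allFin-punchIn {suc n} (suc j) p = begin
  allB p (allFin (suc (suc n)))                               ≡⟨ allB-allFin-suc p ⟩
  p zero ∧ allB (p ∘ suc) (allFin (suc n))                    ≡⟨ cong (p zero ∧_) (allB-allFin-punchIn j (p ∘ suc)) ⟩
  p zero ∧ (p (suc j) ∧ allB (p ∘ suc ∘ punchIn j) (allFin n)) ≡⟨ ∧-swap (p zero) (p (suc j)) _ ⟩
  p (suc j) ∧ (p zero ∧ allB (p ∘ suc ∘ punchIn j) (allFin n)) ≡⟨ cong (p (suc j) ∧_) (allB-allFin-suc (p ∘ punchIn (suc j))) ⟨
  p (suc j) ∧ allB (p ∘ punchIn (suc j)) (allFin (suc n))     ∎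
  where
  ∧-swap : ∀ a b c → a ∧ (b ∧ c) ≡ b ∧ (a ∧ c)
  ∧-swap true  b c = refl
  ∧-swap false b c = sym (∧-zeroʳ b)

degree-zero : (v : Vec Bool n) (t : EdgeSet n) → degree {suc n} (v , t) zero ≡ ∣ v ∣
degree-zero v t = trans (countTrue-map-allFin-suc (adj (v , t) zero)) (cong countTrue (map-lookup-allFin v))

degree-suc : (v : Vec Bool n) (t : EdgeSet n) (u : Fin n) → degree {suc n} (v , t) (suc u) ≡ bump (lookup v u) (degree t u)
degree-suc v t u = countTrue-map-allFin-suc (adj (v , t) (suc u))

degree-star : (j : Fin (suc n)) (E : EdgeSet (suc n)) → degree E j ≡ ∣ star j E ∣
degree-star         zero    (v , t) = degree-zero v t
degree-star {suc n} (suc j) (v , t) = trans (degree-suc v t j) (cong (bump (lookup v j)) (degree-star j t))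

degree-punchIn : (j : Fin (suc n)) (E : EdgeSet (suc n)) (u : Fin n) →
                 degree E (punchIn j u) ≡ bump (lookup (star j E) u) (degree (delete j E) u)
degree-punchIn         zero    (v , t) u       = degree-suc v t u
degree-punchIn {suc n} (suc j) (v , t) zero    = begin
  degree (v , t) zero                                         ≡⟨ degree-zero v t ⟩
  ∣ v ∣                                                        ≡⟨ ∣v∣≡bump-removeAt v j ⟩
  bump (lookup v j) ∣ removeAt v j ∣                            ≡⟨ cong (bump (lookup v j)) (degree-zero (removeAt v j) (delete j t)) ⟨
  bump (lookup v j) (degree (removeAt v j , delete j t) zero)  ∎
degree-punchIn {suc n} (suc j) (v , t) (suc u) = begin
  degree (v , t) (suc (punchIn j u))
    ≡⟨ degree-suc v t (punchIn j u) ⟩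
  bump (lookup v (punchIn j u)) (degree t (punchIn j u))
    ≡⟨ cong₂ bump (sym (lookup-removeAt v j u)) (degree-punchIn j t u) ⟩
  bump (lookup (removeAt v j) u) (bump (lookup (star j t) u) (degree (delete j t) u))
    ≡⟨ bump-comm (lookup (removeAt v j) u) (lookup (star j t) u) _ ⟩
  bump (lookup (star j t) u) (bump (lookup (removeAt v j) u) (degree (delete j t) u))
    ≡⟨ cong (bump (lookup (star j t) u)) (degree-suc (removeAt v j) (delete j t) u) ⟨
  bump (lookup (star j t) u) (degree (removeAt v j , delete j t) (suc u))
    ∎

size-star-delete : (j : Fin (suc n)) (E : EdgeSet (suc n)) → size E ≡ ∣ star j E ∣ ℕ.+ size (delete j E)
size-star-delete         zero    (v , t) = refl
size-star-delete {suc n} (suc j) (v , t) = begin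
  ∣ v ∣ ℕ.+ size t
    ≡⟨ cong₂ ℕ._+_ (∣v∣≡bump-removeAt v j) (size-star-delete j t) ⟩
  bump (lookup v j) ∣ removeAt v j ∣ ℕ.+ (∣ star j t ∣ ℕ.+ size (delete j t))
    ≡⟨ bump-+ (lookup v j) _ _ ⟩
  bump (lookup v j) (∣ removeAt v j ∣ ℕ.+ (∣ star j t ∣ ℕ.+ size (delete j t)))
    ≡⟨ cong (bump (lookup v j)) (swap-front ∣ removeAt v j ∣ ∣ star j t ∣ (size (delete j t))) ⟩
  bump (lookup v j) (∣ star j t ∣ ℕ.+ (∣ removeAt v j ∣ ℕ.+ size (delete j t)))
    ≡⟨ bump-+ (lookup v j) _ _ ⟨
  bump (lookup v j) ∣ star j t ∣ ℕ.+ (∣ removeAt v j ∣ ℕ.+ size (delete j t))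
    ∎
  where
  swap-front : ∀ a b c → a ℕ.+ (b ℕ.+ c) ≡ b ℕ.+ (a ℕ.+ c)
  swap-front = ℕ.solve-∀

isMatching-∷ : (v : Vec Bool n) (t : EdgeSet n) →
  isMatching {suc n} (v , t) ≡ (∣ v ∣ ≤ᵇ 1) ∧ allB (λ u → bump (lookup v u) (degree t u) ≤ᵇ 1) (allFin n)
isMatching-∷ {n} v t = trans (allB-allFin-suc (λ u → degree (v , t) u ≤ᵇ 1))
  (cong₂ _∧_ (cong (_≤ᵇ 1) (degree-zero v t)) (allB-cong (λ u → cong (_≤ᵇ 1) (degree-suc v t u)) (allFin n)))

isMatchingOfSize : ℕ → {n : ℕ} → EdgeSet n → Bool
isMatchingOfSize k E = isMatching E ∧ does (size E ℕ.≟ k)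

isMatchingOfSize-⊥ : (k : ℕ) (t : EdgeSet n) → isMatchingOfSize k {suc n} (⊥ , t) ≡ isMatchingOfSize k t
isMatchingOfSize-⊥ {n} k t = cong₂ _∧_ matching (cong (λ s → does (s ℕ.+ size t ℕ.≟ k)) (∣⊥∣≡0 n))
  where
  matching : isMatching {suc n} (⊥ , t) ≡ isMatching t
  matching = trans (isMatching-∷ ⊥ t) (cong₂ _∧_ (cong (_≤ᵇ 1) (∣⊥∣≡0 n))
    (allB-cong (λ u → cong (λ b → bump b (degree t u) ≤ᵇ 1) (lookup-replicate u false)) (allFin n)))

isMatchingOfSize-≥2 : (k : ℕ) (v : Vec Bool n) (t : EdgeSet n) → 2 ≤ ∣ v ∣ → isMatchingOfSize k (v , t) ≡ false
isMatchingOfSize-≥2 {n} k v t 2≤∣v∣ = cong (_∧ does (size {suc n} (v , t) ℕ.≟ k)) not-matching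
  where
  ≤ᵇ1≡false : ∀ {d} → 2 ≤ d → (d ≤ᵇ 1) ≡ false
  ≤ᵇ1≡false (s≤s (s≤s _)) = refl
  not-matching : isMatching {suc n} (v , t) ≡ false
  not-matching = trans (isMatching-∷ v t)
    (cong (_∧ allB (λ u → bump (lookup v u) (degree t u) ≤ᵇ 1) (allFin n)) (≤ᵇ1≡false 2≤∣v∣))

isMatching-⁅⁆ : {m : ℕ} (j : Fin (suc m)) (t : EdgeSet (suc m)) →
  isMatching {suc (suc m)} (⁅ j ⁆ , t) ≡ (suc (degree t j) ≤ᵇ 1) ∧ allB (λ u → degree t (punchIn j u) ≤ᵇ 1) (allFin m)
isMatching-⁅⁆ {m} j t = begin
  isMatching (⁅ j ⁆ , t)
    ≡⟨ isMatching-∷ ⁅ j ⁆ t ⟩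
  (∣ ⁅ j ⁆ ∣ ≤ᵇ 1) ∧ allB P (allFin (suc m))
    ≡⟨ cong₂ _∧_ (cong (_≤ᵇ 1) (∣⁅j⁆∣≡1 j)) (allB-allFin-punchIn j P) ⟩
  P j ∧ allB (P ∘ punchIn j) (allFin m)
    ≡⟨ cong₂ _∧_ (cong (λ b → bump b (degree t j) ≤ᵇ 1) (lookup-⁅j⁆-j j))
                 (allB-cong (λ u → cong (λ b → bump b (degree t (punchIn j u)) ≤ᵇ 1) (lookup-⁅j⁆-punchIn j u)) (allFin m)) ⟩
  (suc (degree t j) ≤ᵇ 1) ∧ allB (λ u → degree t (punchIn j u) ≤ᵇ 1) (allFin m)
    ∎
  where
  P : Fin (suc m) → Bool
  P u = bump (lookup ⁅ j ⁆ u) (degree t u) ≤ᵇ 1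

-- Vertex 0 can be matched to j + 1 only if j + 1 is isolated in t, and the other edges then form
-- a matching of delete j t.
isMatchingOfSize-⁅⁆ : {m : ℕ} (k : ℕ) (j : Fin (suc m)) (t : EdgeSet (suc m)) →
  𝟙 (isMatchingOfSize (suc k) {suc (suc m)} (⁅ j ⁆ , t)) ≡
  𝟙 (does (∣ star j t ∣ ℕ.≟ 0)) * 𝟙 (isMatchingOfSize k (delete j t))
isMatchingOfSize-⁅⁆ {m} k j t with ∣ star j t ∣ in ∣star∣≡
... | suc d = cong (λ b → 𝟙 (b ∧ does (size {suc (suc m)} (⁅ j ⁆ , t) ℕ.≟ suc k))) not-matching
  where
  not-matching : isMatching {suc (suc m)} (⁅ j ⁆ , t) ≡ false
  not-matching = trans (isMatching-⁅⁆ j t)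
    (cong (λ e → (suc e ≤ᵇ 1) ∧ allB (λ u → degree t (punchIn j u) ≤ᵇ 1) (allFin m)) (trans (degree-star j t) ∣star∣≡))
... | zero  = trans (cong 𝟙 (cong₂ _∧_ matching sized)) (sym (ℤ.*-identityˡ _))
  where
  isolated : ∀ u → degree t (punchIn j u) ≡ degree (delete j t) u
  isolated u = trans (degree-punchIn j t u)
    (cong (λ b → bump b (degree (delete j t) u)) (∣v∣≡0⇒lookup≡false (star j t) ∣star∣≡ u))
  matching : isMatching {suc (suc m)} (⁅ j ⁆ , t) ≡ isMatching (delete j t)
  matching = trans (isMatching-⁅⁆ j t)
    (cong₂ (λ e b → (suc e ≤ᵇ 1) ∧ b) (trans (degree-star j t) ∣star∣≡)
                                      (allB-cong (λ u → cong (_≤ᵇ 1) (isolated u)) (allFin m)))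
  sized : does (size {suc (suc m)} (⁅ j ⁆ , t) ℕ.≟ suc k) ≡ does (size (delete j t) ℕ.≟ k)
  sized = cong (λ s → does (s ℕ.≟ suc k))
    (cong₂ ℕ._+_ (∣⁅j⁆∣≡1 j) (trans (size-star-delete j t) (cong (ℕ._+ size (delete j t)) ∣star∣≡)))

isMatchingOfSize-zero-⁅⁆ : {m : ℕ} (j : Fin (suc m)) (t : EdgeSet (suc m)) →
                           isMatchingOfSize 0 {suc (suc m)} (⁅ j ⁆ , t) ≡ false
isMatchingOfSize-zero-⁅⁆ j t = trans (cong (λ s → isMatching (⁅ j ⁆ , t) ∧ does (s ℕ.+ size t ℕ.≟ 0)) (∣⁅j⁆∣≡1 j))
                                     (∧-zeroʳ (isMatching (⁅ j ⁆ , t)))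

∑-allVecs-⊥ : (n : ℕ) (G : Vec Bool n → ℤ) → (∀ v → 1 ≤ ∣ v ∣ → G v ≡ + 0) →
              ∑[ v ∈ allVecs n ] G v ≡ G ⊥
∑-allVecs-⊥ zero    G G≡0 = ℤ.+-identityʳ _
∑-allVecs-⊥ (suc n) G G≡0 = begin
  ∑[ v ∈ allVecs (suc n) ] G v
    ≡⟨ ∑-allVecs-suc n G ⟩
  ∑[ w ∈ allVecs n ] (G (true ∷ᵥ w) + G (false ∷ᵥ w))
    ≡⟨ ∑ₗ-distrib-+ (allVecs n) _ _ ⟩
  ∑[ w ∈ allVecs n ] G (true ∷ᵥ w) + ∑[ w ∈ allVecs n ] G (false ∷ᵥ w)
    ≡⟨ cong₂ _+_ (trans (∑ₗ-cong (allVecs n) (λ w → G≡0 (true ∷ᵥ w) (s≤s ℕ.z≤n))) (∑ₗ-zero (allVecs n)))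
                 (∑-allVecs-⊥ n (G ∘ (false ∷ᵥ_)) (λ w → G≡0 (false ∷ᵥ w))) ⟩
  + 0 + G ⊥
    ≡⟨ ℤ.+-identityˡ _ ⟩
  G ⊥
    ∎

∑-allVecs-⊥-⁅⁆ : (n : ℕ) (F : Vec Bool n → ℤ) → (∀ v → 2 ≤ ∣ v ∣ → F v ≡ + 0) →
                 ∑[ v ∈ allVecs n ] F v ≡ F ⊥ + ∑[ j < n ] F ⁅ j ⁆
∑-allVecs-⊥-⁅⁆ zero    F F≡0 = refl
∑-allVecs-⊥-⁅⁆ (suc n) F F≡0 = begin
  ∑[ v ∈ allVecs (suc n) ] F v
    ≡⟨ ∑-allVecs-suc n F ⟩
  ∑[ w ∈ allVecs n ] (F (true ∷ᵥ w) + F (false ∷ᵥ w))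
    ≡⟨ ∑ₗ-distrib-+ (allVecs n) _ _ ⟩
  ∑[ w ∈ allVecs n ] F (true ∷ᵥ w) + ∑[ w ∈ allVecs n ] F (false ∷ᵥ w)
    ≡⟨ cong₂ _+_ (∑-allVecs-⊥ n (F ∘ (true ∷ᵥ_)) (λ w 1≤∣w∣ → F≡0 (true ∷ᵥ w) (s≤s 1≤∣w∣)))
                 (∑-allVecs-⊥-⁅⁆ n (F ∘ (false ∷ᵥ_)) (λ w → F≡0 (false ∷ᵥ w))) ⟩
  F ⁅ zero ⁆ + (F (false ∷ᵥ ⊥) + ∑[ j < n ] F ⁅ suc j ⁆)
    ≡⟨ swap-front (F ⁅ zero ⁆) (F ⊥) _ ⟩
  F ⊥ + ∑[ j < suc n ] F ⁅ j ⁆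
    ∎
  where
  swap-front : ∀ a b c → a + (b + c) ≡ b + (a + c)
  swap-front a b c = trans (sym (ℤ.+-assoc a b c)) (trans (cong (_+ c) (ℤ.+-comm a b)) (ℤ.+-assoc b a c))

∑-allVecs-𝟙[∣v∣≡0] : (n : ℕ) → ∑[ v ∈ allVecs n ] 𝟙 (does (∣ v ∣ ℕ.≟ 0)) ≡ + 1
∑-allVecs-𝟙[∣v∣≡0] n = trans (∑-allVecs-⊥ n (λ v → 𝟙 (does (∣ v ∣ ℕ.≟ 0))) nonempty)
                            (cong (λ c → 𝟙 (does (c ℕ.≟ 0))) (∣⊥∣≡0 n))
  where
  nonempty : ∀ v → 1 ≤ ∣ v ∣ → 𝟙 (does (∣ v ∣ ℕ.≟ 0)) ≡ + 0
  nonempty v 1≤∣v∣ with ∣ v ∣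
  nonempty v (s≤s _) | suc _ = refl

matchingSum : ℕ → ℕ → ℤ
matchingSum n k = ∑[ E ∈ allTours n ] 𝟙 (isMatchingOfSize k E)

matchingSum-suc : (n k : ℕ) →
  matchingSum (suc n) k ≡ matchingSum n k + ∑[ j < n ] ∑[ t ∈ allTours n ] 𝟙 (isMatchingOfSize k {suc n} (⁅ j ⁆ , t))
matchingSum-suc n k = begin
  matchingSum (suc n) k
    ≡⟨ ∑-allTours-suc n _ ⟩
  ∑[ v ∈ allVecs n ] ∑[ t ∈ allTours n ] χ (v , t)
    ≡⟨ ∑ₗ-comm (allVecs n) (allTours n) (λ v t → χ (v , t)) ⟩
  ∑[ t ∈ allTours n ] ∑[ v ∈ allVecs n ] χ (v , t)
    ≡⟨ ∑ₗ-cong (allTours n) (λ t → ∑-allVecs-⊥-⁅⁆ n (λ v → χ (v , t)) (λ v 2≤∣v∣ → cong 𝟙 (isMatchingOfSize-≥2 k v t 2≤∣v∣))) ⟩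
  ∑[ t ∈ allTours n ] (χ (⊥ , t) + ∑[ j < n ] χ (⁅ j ⁆ , t))
    ≡⟨ ∑ₗ-distrib-+ (allTours n) _ _ ⟩
  ∑[ t ∈ allTours n ] χ (⊥ , t) + ∑[ t ∈ allTours n ] ∑[ j < n ] χ (⁅ j ⁆ , t)
    ≡⟨ cong₂ _+_ (∑ₗ-cong (allTours n) (λ t → cong 𝟙 (isMatchingOfSize-⊥ k t)))
                 (∑ₗ-∑-comm (allTours n) n (λ t j → χ (⁅ j ⁆ , t))) ⟩
  matchingSum n k + ∑[ j < n ] ∑[ t ∈ allTours n ] χ (⁅ j ⁆ , t)
    ∎
  where
  χ : EdgeSet (suc n) → ℤ
  χ E = 𝟙 (isMatchingOfSize k E)

∑-allTours-⁅⁆ : (m k : ℕ) (j : Fin (suc m)) →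
  ∑[ t ∈ allTours (suc m) ] 𝟙 (isMatchingOfSize (suc k) {suc (suc m)} (⁅ j ⁆ , t)) ≡ matchingSum m k
∑-allTours-⁅⁆ m k j = begin
  ∑[ t ∈ allTours (suc m) ] 𝟙 (isMatchingOfSize (suc k) (⁅ j ⁆ , t))
    ≡⟨ ∑ₗ-cong (allTours (suc m)) (isMatchingOfSize-⁅⁆ k j) ⟩
  ∑[ t ∈ allTours (suc m) ] (𝟙 (does (∣ star j t ∣ ℕ.≟ 0)) * 𝟙 (isMatchingOfSize k (delete j t)))
    ≡⟨ ∑-allTours-star-delete m j (λ s → 𝟙 (does (∣ s ∣ ℕ.≟ 0))) (λ t → 𝟙 (isMatchingOfSize k t)) ⟩
  ∑[ s ∈ allVecs m ] 𝟙 (does (∣ s ∣ ℕ.≟ 0)) * matchingSum m k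
    ≡⟨ cong (_* matchingSum m k) (∑-allVecs-𝟙[∣v∣≡0] m) ⟩
  + 1 * matchingSum m k
    ≡⟨ ℤ.*-identityˡ _ ⟩
  matchingSum m k
    ∎

matchingSum≡pairings : (n k : ℕ) → matchingSum n k ≡ + pairings n k
matchingSum≡pairings zero          zero    = refl
matchingSum≡pairings zero          (suc k) = refl
matchingSum≡pairings (suc zero)    k       = trans (matchingSum-suc 0 k) (trans (ℤ.+-identityʳ _) (lemma k))
  where
  lemma : ∀ k → matchingSum 0 k ≡ + pairings 1 k
  lemma zero    = refl
  lemma (suc k) = cong +_ (sym (pairings-vanish 1 (suc k) (ℕ.*-monoʳ-≤ 2 (s≤s ℕ.z≤n))))
matchingSum≡pairings (suc (suc m)) zero    = begin
  matchingSum (suc (suc m)) 0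
    ≡⟨ matchingSum-suc (suc m) 0 ⟩
  matchingSum (suc m) 0 + ∑[ j < suc m ] ∑[ t ∈ allTours (suc m) ] 𝟙 (isMatchingOfSize 0 (⁅ j ⁆ , t))
    ≡⟨ cong₂ _+_ (matchingSum≡pairings (suc m) 0)
                 (trans (sum-cong-≗ {suc m} (λ j → trans (∑ₗ-cong (allTours (suc m)) (λ t → cong 𝟙 (isMatchingOfSize-zero-⁅⁆ j t)))
                                                           (∑ₗ-zero (allTours (suc m)))))
                        (sum-replicate-zero (suc m))) ⟩
  + 1 + + 0
    ∎
matchingSum≡pairings (suc (suc m)) (suc k) = begin
  matchingSum (suc (suc m)) (suc k)
    ≡⟨ matchingSum-suc (suc m) (suc k) ⟩
  matchingSum (suc m) (suc k) + ∑[ j < suc m ] ∑[ t ∈ allTours (suc m) ] 𝟙 (isMatchingOfSize (suc k) (⁅ j ⁆ , t))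
    ≡⟨ cong₂ _+_ (matchingSum≡pairings (suc m) (suc k))
                 (trans (sum-cong-≗ {suc m} (λ j → trans (∑-allTours-⁅⁆ m k j) (matchingSum≡pairings m k)))
                        (∑-const (suc m) (+ pairings m k))) ⟩
  + pairings (suc m) (suc k) + + suc m * + pairings m k
    ≡⟨ cong (_+_ (+ pairings (suc m) (suc k))) (ℤ.pos-* (suc m) (pairings m k)) ⟨
  + pairings (suc m) (suc k) + + (suc m ℕ.* pairings m k)
    ≡⟨ ℤ.pos-+ (pairings (suc m) (suc k)) _ ⟨
  + (pairings (suc m) (suc k) ℕ.+ suc m ℕ.* pairings m k)
    ≡⟨ cong +_ (pairings-suc-suc m k) ⟨
  + pairings (suc (suc m)) (suc k)
    ∎

matchings≡pairings : (n k : ℕ) → matchings n k ≡ pairings n k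
matchings≡pairings n k = ℤ.+-injective (trans (+countTrue≡∑𝟙 (isMatchingOfSize k) (allTours n)) (matchingSum≡pairings n k))

totalCoeff-0 : ∀ i → totalCoeff 0 i ≡ coeff (expectedCharPoly 0) i
totalCoeff-0 zero    = refl
totalCoeff-0 (suc i) = refl

totalCoeff-1 : ∀ i → totalCoeff 1 i ≡ coeff (expectedCharPoly 1) i
totalCoeff-1 zero          = refl
totalCoeff-1 (suc zero)    = refl
totalCoeff-1 (suc (suc i)) = refl

[1+n]C2≡n+nC2 : ∀ n → suc n C 2 ≡ n ℕ.+ n C 2
[1+n]C2≡n+nC2 n = trans (sym (nCk+nC[k+1]≡[n+1]C[k+1] n 1)) (cong (ℕ._+ n C 2) (nC1≡n n))

2^[1+n]C2 : ∀ n → (+ 2) ^ (suc n C 2) ≡ (+ 2) ^ n * (+ 2) ^ (n C 2)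
2^[1+n]C2 n = trans (cong ((+ 2) ^_) ([1+n]C2≡n+nC2 n)) (ℤ.^-distribˡ-+-* (+ 2) n (n C 2))

totalCoeff≡2^nC2*expected : ∀ n i → totalCoeff n i ≡ (+ 2) ^ (n C 2) * coeff (expectedCharPoly n) i
totalCoeff≡2^nC2*expected zero          i = trans (totalCoeff-0 i) (sym (ℤ.*-identityˡ _))
totalCoeff≡2^nC2*expected (suc zero)    i = trans (totalCoeff-1 i) (sym (ℤ.*-identityˡ _))
totalCoeff≡2^nC2*expected (suc (suc m)) i = begin
  totalCoeff (suc (suc m)) i
    ≡⟨ totalCoeff-suc-suc m i ⟩
  a * (shift (totalCoeff (suc m)) i + + suc m * (b * totalCoeff m i))
    ≡⟨ cong₂ (λ x y → a * (x + + suc m * (b * y)))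
             (trans (shift-cong (totalCoeff≡2^nC2*expected (suc m)) i) (shift-* ((+ 2) ^ (suc m C 2)) R₁ i))
             (totalCoeff≡2^nC2*expected m i) ⟩
  a * ((+ 2) ^ (suc m C 2) * shift R₁ i + + suc m * (b * (c * R₀ i)))
    ≡⟨ cong (λ x → a * (x * shift R₁ i + + suc m * (b * (c * R₀ i)))) (2^[1+n]C2 m) ⟩
  a * (b * c * shift R₁ i + + suc m * (b * (c * R₀ i)))
    ≡⟨ factor a b c (shift R₁ i) (+ suc m) (R₀ i) ⟩
  a * (b * c) * (shift R₁ i + + suc m * R₀ i)
    ≡⟨ cong₂ _*_ (trans (2^[1+n]C2 (suc m)) (cong (a *_) (2^[1+n]C2 m)))
                 (coeff-expectedCharPoly-suc-suc m i) ⟨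
  (+ 2) ^ (suc (suc m) C 2) * coeff (expectedCharPoly (suc (suc m))) i
    ∎
  where
  a b c : ℤ
  a = (+ 2) ^ suc m
  b = (+ 2) ^ m
  c = (+ 2) ^ (m C 2)
  R₀ R₁ : ℕ → ℤ
  R₀ = coeff (expectedCharPoly m)
  R₁ = coeff (expectedCharPoly (suc m))
  factor : ∀ a b c x s y → a * (b * c * x + s * (b * (c * y))) ≡ a * (b * c) * (x + s * y)
  factor = solve-∀

+[m^n]≡[+m]^n : ∀ m n → + (m ℕ.^ n) ≡ (+ m) ^ n
+[m^n]≡[+m]^n m zero    = refl
+[m^n]≡[+m]^n m (suc n) = trans (ℤ.pos-* m (m ℕ.^ n)) (cong (+ m *_) (+[m^n]≡[+m]^n m n))

[d*a]/d≡a/1 : (a : ℤ) (d : ℕ) .{{_ : NonZero d}} → (+ d * a) ℚ./ d ≡ a ℚ./ 1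
[d*a]/d≡a/1 a (suc d) = ℚ.fromℚᵘ-cong {mkℚᵘ (+ suc d * a) d} {mkℚᵘ a 0} (*≡* (cross (+ suc d) a))
  where
  cross : ∀ x a → x * a * + 1 ≡ a * x
  cross = solve-∀

expect-coeff-charPoly : ∀ n i →
  expect n (λ T → coeff (charPoly n (seidel T)) i) ≡ coeff (expectedCharPoly n) i ℚ./ 1
expect-coeff-charPoly n i = begin
  (totalCoeff n i ℚ./ 2 ℕ.^ (n C 2)) {{ℕ.m^n≢0 2 (n C 2)}}
    ≡⟨ cong (λ x → (x ℚ./ 2 ℕ.^ (n C 2)) {{ℕ.m^n≢0 2 (n C 2)}}) total ⟩
  ((+ (2 ℕ.^ (n C 2)) * coeff (expectedCharPoly n) i) ℚ./ 2 ℕ.^ (n C 2)) {{ℕ.m^n≢0 2 (n C 2)}}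
    ≡⟨ [d*a]/d≡a/1 (coeff (expectedCharPoly n) i) (2 ℕ.^ (n C 2)) {{ℕ.m^n≢0 2 (n C 2)}} ⟩
  coeff (expectedCharPoly n) i ℚ./ 1
    ∎
  where
  total : totalCoeff n i ≡ + (2 ℕ.^ (n C 2)) * coeff (expectedCharPoly n) i
  total = trans (totalCoeff≡2^nC2*expected n i)
                (cong (_* coeff (expectedCharPoly n) i) (sym (+[m^n]≡[+m]^n 2 (n C 2))))

theorem7p7 : (n : ℕ) → 1 ≤ n →
    ((k : ℕ) → k ≤ n / 2 →
      (expect n (λ T → coeff (charPoly n (seidel T)) (n ∸ 2 ℕ.* k))
         ≡ (+ matchings n k) ℚ./ 1)
      × (matchings n k ≡ (n C (2 ℕ.* k)) ℕ.* oddDF k))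
    × ((i : ℕ) → expect n (λ T → coeff (charPoly n (seidel T)) i)
                   ≡ coeff (expectedCharPoly n) i ℚ./ 1)
theorem7p7 n _ = (λ k k≤n/2 → top-coefficient k k≤n/2 , matchings≡pairings n k) , expect-coeff-charPoly n
  where
  top-coefficient : ∀ k → k ≤ n / 2 →
    expect n (λ T → coeff (charPoly n (seidel T)) (n ∸ 2 ℕ.* k)) ≡ (+ matchings n k) ℚ./ 1
  top-coefficient k k≤n/2 = begin
    expect n (λ T → coeff (charPoly n (seidel T)) (n ∸ 2 ℕ.* k))  ≡⟨ expect-coeff-charPoly n (n ∸ 2 ℕ.* k) ⟩
    coeff (expectedCharPoly n) (n ∸ 2 ℕ.* k) ℚ./ 1                ≡⟨ cong (ℚ._/ 1) (coeff-expectedCharPoly-top n k k≤n/2) ⟩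
    + pairings n k ℚ./ 1                                           ≡⟨ cong (λ m → + m ℚ./ 1) (matchings≡pairings n k) ⟨
    + matchings n k ℚ./ 1                                          ∎
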